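{- Let $\phi=\exists x\,(\varphi(x))\in\mathcal{F}$ be a sentence. Then there exists a sentence $\hat\phi=\exists x\,(\hat\varphi(x))\in\mathcal{F}$ in no-equivalence prenex normal form such that $\phi\cong\hat\phi$ and $\mathrm{ch}(\phi)=\mathrm{ch}(\hat\phi)$.
   Context: $\mathcal{F}$ denotes the set of first order graph formulas built from variables, the relational symbols $\sim,=,\nsim,\neq$, $\wedge$, $\vee$, $\forall$, $\exists$ (no negation). The nesting forest $F(\phi)$ is defined recursively: empty for atomic formulas; disjoint union for $\wedge,\vee$; for $\exists x\,\varphi$ (resp. $\forall x\,\varphi$) a new root labeled $\exists$ (resp. $\forall$) joined to the roots of the trees of $F(\varphi)$. $\mathrm{ch}(\phi)$ is the maximum over paths in $F(\phi)$ starting at a root of the number of pairs of consecutive vertices with different labels. Formulas $\phi_1,\phi_2$ with the same free variables are equivalent, $\phi_1\cong\phi_2$, if there is $n$ such that for every graph on at least $n$ vertices and every assignment of its vertices to the free variables both are true or both are false. A sentence is in no-equivalence prenex normal form (NEPNF) if it has the form $z_1x_1\ldots z_mx_m\,\phi_m(x_1,\ldots,x_m)$, $z_i\in\{\forall,\exists\}$, where $\phi_1$ is a quantifier-free formula of $\mathcal{F}$ without $=,\neq$, and for $j=1,\ldots,m-1$, $\phi_{j+1}=(x_{j+1}\neq x_j)\wedge\ldots\wedge(x_{j+1}\neq x_1)\wedge\phi_j$ if $z_{j+1}=\exists$ and $\phi_{j+1}=(x_{j+1}=x_j)\vee\ldots\vee(x_{j+1}=x_1)\vee\phi_j$ if $z_{j+1}=\forall$.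 -}

module Defs where

open import Data.Nat using (ℕ; zero; suc; _≤_; _⊔_; _≟_)
open import Data.Fin using (Fin)
open import Data.Bool using (Bool; true; false)
open import Data.List using (List; []; _∷_; _++_; map; foldr; reverse)
open import Data.List.Relation.Unary.Unique.Propositional using (Unique)
open import Data.Product using (Σ; _×_; _,_; proj₂; ∃-syntax)
open import Data.Sum using (_⊎_)
open import Relation.Nullary using (¬_; yes; no)
open import Relation.Binary.PropositionalEquality using (_≡_; _≢_)
open import Function.Bundles using (_⇔_)

data Q : Set where
  ∃Q ∀Q : Q

data Form : Set where
  _∼_ _≁_ _==_ _≠_ : ℕ → ℕ → Form
  _∧_ _∨_ : Form → Form → Form
  quant : Q → ℕ → Form → Form

infixr 6 _∧_
infixr 5 _∨_

data FreeIn (x : ℕ) : Form → Set where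
  f∼ˡ : ∀ {y} → FreeIn x (x ∼ y)
  f∼ʳ : ∀ {y} → FreeIn x (y ∼ x)
  f≁ˡ : ∀ {y} → FreeIn x (x ≁ y)
  f≁ʳ : ∀ {y} → FreeIn x (y ≁ x)
  f=ˡ : ∀ {y} → FreeIn x (x == y)
  f=ʳ : ∀ {y} → FreeIn x (y == x)
  f≠ˡ : ∀ {y} → FreeIn x (x ≠ y)
  f≠ʳ : ∀ {y} → FreeIn x (y ≠ x)
  f∧ˡ : ∀ {φ ψ} → FreeIn x φ → FreeIn x (φ ∧ ψ)
  f∧ʳ : ∀ {φ ψ} → FreeIn x ψ → FreeIn x (φ ∧ ψ)
  f∨ˡ : ∀ {φ ψ} → FreeIn x φ → FreeIn x (φ ∨ ψ)
  f∨ʳ : ∀ {φ ψ} → FreeIn x ψ → FreeIn x (φ ∨ ψ)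
  fQ  : ∀ {z y φ} → x ≢ y → FreeIn x φ → FreeIn x (quant z y φ)

Sentence : Form → Set
Sentence φ = ∀ x → ¬ FreeIn x φ

record Graph (n : ℕ) : Set where
  field
    E      : Fin n → Fin n → Bool
    sym    : ∀ u v → E u v ≡ E v u
    irrefl : ∀ v → E v v ≡ false
open Graph public

_[_↦_] : ∀ {n} → (ℕ → Fin n) → ℕ → Fin n → (ℕ → Fin n)
(ρ [ x ↦ v ]) y with y ≟ x
... | yes _ = v
... | no  _ = ρ y

Sat : ∀ {n} → Graph n → (ℕ → Fin n) → Form → Set
Sat G ρ (x ∼ y)  = E G (ρ x) (ρ y) ≡ true
Sat G ρ (x ≁ y)  = E G (ρ x) (ρ y) ≡ false
Sat G ρ (x == y) = ρ x ≡ ρ y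
Sat G ρ (x ≠ y)  = ρ x ≢ ρ y
Sat G ρ (φ ∧ ψ)  = Sat G ρ φ × Sat G ρ ψ
Sat G ρ (φ ∨ ψ)  = Sat G ρ φ ⊎ Sat G ρ ψ
Sat G ρ (quant ∃Q x φ) = Σ (Fin _) λ v → Sat G (ρ [ x ↦ v ]) φ
Sat G ρ (quant ∀Q x φ) = (v : Fin _) → Sat G (ρ [ x ↦ v ]) φ

SameFree : Form → Form → Set
SameFree φ ψ = ∀ x → (FreeIn x φ → FreeIn x ψ) × (FreeIn x ψ → FreeIn x φ)

_≅_ : Form → Form → Set
φ ≅ ψ = SameFree φ ψ × ∃[ N ] (∀ n → N ≤ n → (G : Graph n) (ρ : ℕ → Fin n) →
          Sat G ρ φ ⇔ Sat G ρ ψ)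

data Tree : Set where
  node : Q → List Tree → Tree

Forest : Set
Forest = List Tree

F : Form → Forest
F (x ∼ y)  = []
F (x ≁ y)  = []
F (x == y) = []
F (x ≠ y)  = []
F (φ ∧ ψ)  = F φ ++ F ψ
F (φ ∨ ψ)  = F φ ++ F ψ
F (quant z x φ) = node z (F φ) ∷ []

diff : Q → Q → ℕ
diff ∃Q ∃Q = 0
diff ∀Q ∀Q = 0
diff _  _  = 1

label : Tree → Q
label (node z _) = z

-- chT t : max over paths from the root of t of the number of label changes
chT : Tree → ℕ
chChildren : Q → List Tree → ℕ
chT (node z ts) = chChildren z ts
chChildren z [] = 0
chChildren z (node w us ∷ ts) = (diff z w Data.Nat.+ chChildren w us) ⊔ chChildren z ts

chF : Forest → ℕ
chF [] = 0
chF (t ∷ ts) = chT t ⊔ chF ts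

ch : Form → ℕ
ch φ = chF (F φ)

data QFNoEq : Form → Set where
  q∼ : ∀ {x y} → QFNoEq (x ∼ y)
  q≁ : ∀ {x y} → QFNoEq (x ≁ y)
  q∧ : ∀ {φ ψ} → QFNoEq φ → QFNoEq ψ → QFNoEq (φ ∧ ψ)
  q∨ : ∀ {φ ψ} → QFNoEq φ → QFNoEq ψ → QFNoEq (φ ∨ ψ)

guard : Q → ℕ → List ℕ → Form → Form
guard ∃Q x ys ψ = foldr (λ y acc → (x ≠ y) ∧ acc) ψ ys
guard ∀Q x ys ψ = foldr (λ y acc → (x == y) ∨ acc) ψ ys

-- matrix R φ₁, R = [(z_j,x_j), …, (z_1,x_1)] (reversed prefix), gives φ_j
matrix : List (Q × ℕ) → Form → Form
matrix [] φ = φ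
matrix ((z , x) ∷ []) φ = φ
matrix ((z , x) ∷ R@(_ ∷ _)) φ = guard z x (map proj₂ R) (matrix R φ)

prefix : List (Q × ℕ) → Form → Form
prefix [] ψ = ψ
prefix ((z , x) ∷ L) ψ = quant z x (prefix L ψ)

NEPNF : Form → Set
NEPNF φ = Σ (List (Q × ℕ)) λ L → Σ Form λ φ₁ →
  QFNoEq φ₁ × Unique (map proj₂ L) × (φ ≡ prefix L (matrix (reverse L) φ₁))

module Submission where

-- The proof compiles ∃x φ in two
-- stages through an auxiliary language of quantifier-free matrices over
-- names (free variables, renamed bound variables, output variables c_j).
--
--  1. Prenexing with alternation control (pren, pren-sem).  A formula
--     whose nesting forest has fewer than K label changes below a
--     quantifier s becomes an alternating prefix of K blocks s B₁ s̄ B₂ …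
--     followed by a matrix.  The two sides of ∧/∨ get disjoint bound names
--     and their blocks are interleaved: over a nonempty domain quantifiers
--     commute with ∧ and ∨ (comb).
--  2. Equality elimination (elimEq, elimEq-sem).  The prefix is replaced by
--     one whose quantifiers range over vertices distinct from all earlier
--     ones: each bound variable either equals an earlier output variable or
--     is a new one (decompose), so every matrix becomes a family (a
--     disjunction under ∃, a conjunction under ∀) of renamed matrices,
--     merged back into one matrix at each block boundary.  A vacuous
--     quantifier opens every block, so no block is empty.  This needs more
--     vertices than output variables.
--
-- The output is rendered as an 𝓕-formula in NEPNF (toQF, nepnf-sem): the
-- guards of the NEPNF matrix restrict each quantifier to new vertices, and
-- equality atoms between distinct output variables are decided statically.
-- Its nesting forest is a single path whose label changes are exactly the
-- block boundaries (elimEq-changes, chChildren-prefix), so ch is preserved.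

open import Defs hiding (sym)
open import Data.Nat using (ℕ; zero; suc; _≟_; _≤_; _<_; _⊔_; _+_; z≤n; s≤s; _<?_)
open import Data.Nat.Properties
  using (⊔-assoc; m⊔n≤o⇒m≤o; m⊔n≤o⇒n≤o; ⊔-identityʳ; +-suc; +-identityʳ; ≤-trans; n≤1+n;
         m≤m+n; <-irrefl; ≤-refl; m+n≤o⇒m≤o; <⇒≤; ≤∧≢⇒<; ≮⇒≥; <-≤-trans; ≤-pred)
open import Data.Fin using (Fin) renaming (_≟_ to _≟F_)
import Data.Fin.Properties as Finₚ
open import Data.Bool using (Bool; true; false) renaming (_≟_ to _≟B_)
open import Data.List using (List; []; _∷_; _++_; map; reverse; length; downFrom)
import Data.List.Properties as Listₚ
open import Data.List.Relation.Unary.All as All using (All; []; _∷_)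
import Data.List.Relation.Unary.All.Properties as Allₚ
open import Data.List.Relation.Unary.Any as Any using (Any; here; there)
import Data.List.Relation.Unary.Any.Properties as Anyₚ
open import Data.List.Membership.Propositional using (_∈_; _∉_; find; lose)
import Data.List.Membership.Setoid.Properties as SetoidMembershipₚ
open import Data.List.Membership.Propositional.Properties
  using (∈-map⁺; ∈-map⁻; ∈-downFrom⁺; ∈-downFrom⁻)
open import Data.List.Relation.Unary.Unique.Propositional using (Unique)
import Data.List.Relation.Unary.Unique.Propositional.Properties as Uniqueₚ
open import Data.List.Relation.Unary.AllPairs using ([]; _∷_)
open import Data.List.Relation.Ternary.Interleaving.Propositional
  using (Interleaving; []; consˡ; consʳ)
open import Data.Vec as Vec using (Vec; []; _∷_)
open import Data.Product using (Σ; _×_; _,_; proj₁; proj₂)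
open import Data.Sum using (_⊎_; inj₁; inj₂; [_,_])
import Data.Sum.Properties as Sumₚ
open import Data.Empty using (⊥; ⊥-elim)
open import Data.Unit using (⊤; tt)
open import Relation.Nullary using (¬_; Dec; yes; no; does; contradiction)
open import Relation.Nullary.Decidable using (_×-dec_; _⊎-dec_; ¬?; decidable-stable)
open import Relation.Binary.Definitions using (DecidableEquality)
open import Relation.Binary.PropositionalEquality
  using (_≡_; _≢_; refl; sym; trans; cong; cong₂; subst; subst₂; ≢-sym; module ≡-Reasoning)
  renaming (setoid to ≡-setoid)
open import Function.Bundles using (_⇔_; mk⇔; Equivalence)
import Function.Properties.Equivalence as ⇔
open import Data.Product.Function.NonDependent.Propositional using (_×-⇔_)
open import Data.Sum.Function.Propositional using (_⊎-⇔_)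
open import Function.Related.TypeIsomorphisms using (¬-cong-⇔)

open Equivalence using (to; from)

Σ-⇔ : ∀ {I : Set} {P R : I → Set} → (∀ i → P i ⇔ R i) → Σ I P ⇔ Σ I R
Σ-⇔ h = mk⇔ (λ (i , p) → i , to (h i) p) (λ (i , p) → i , from (h i) p)

Π-⇔ : ∀ {I : Set} {P R : I → Set} → (∀ i → P i ⇔ R i) → ((i : I) → P i) ⇔ ((i : I) → R i)
Π-⇔ h = mk⇔ (λ f i → to (h i) (f i)) (λ f i → from (h i) (f i))

does-⇔ : ∀ {A B : Set} → A ⇔ B → (d : Dec A) (d' : Dec B) → does d ≡ does d'
does-⇔ h (yes a) (yes b) = refl
does-⇔ h (yes a) (no ¬b) = contradiction (to h a) ¬b
does-⇔ h (no ¬a) (yes b) = contradiction (from h b) ¬a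
does-⇔ h (no ¬a) (no ¬b) = refl

retraction⇒injective : ∀ {A B : Set} (f : A → B) (g : B → A) → (∀ a → g (f a) ≡ a) →
                       ∀ {a a'} → f a ≡ f a' → a ≡ a'
retraction⇒injective f g gf {a} {a'} e = trans (sym (gf a)) (trans (cong g e) (gf a'))

flipQ : Q → Q
flipQ ∃Q = ∀Q
flipQ ∀Q = ∃Q

_≟Q_ : DecidableEquality Q
∃Q ≟Q ∃Q = yes refl
∃Q ≟Q ∀Q = no (λ ())
∀Q ≟Q ∃Q = no (λ ())
∀Q ≟Q ∀Q = yes refl

-- A statement Y guarded by a condition F, as under a restricted quantifier
-- of kind z: "F and Y" for ∃, "F implies Y" for ∀.
Guarded : Q → Set → Set → Set
Guarded ∃Q F Y = F × Y
Guarded ∀Q F Y = F → Y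

Guarded-⇔ : ∀ z {F F' Y Y' : Set} → F ⇔ F' → (F → Y ⇔ Y') → Guarded z F Y ⇔ Guarded z F' Y'
Guarded-⇔ ∃Q hF hY =
  mk⇔ (λ (f , y) → to hF f , to (hY f) y) (λ (f' , y') → from hF f' , from (hY (from hF f')) y')
Guarded-⇔ ∀Q hF hY =
  mk⇔ (λ g f' → to (hY (from hF f')) (g (from hF f'))) (λ g f → from (hY f) (g (to hF f)))

-- Names of the auxiliary language: free variables of the input, bound
-- variables (a path recording the renamings that made them distinct), and
-- the output variables c_j.
Name : Set
Name = ℕ ⊎ (List ℕ ⊎ ℕ)

pattern free x   = inj₁ x
pattern bnd p    = inj₂ (inj₁ p)
pattern outVar j = inj₂ (inj₂ j)

_≟N_ : DecidableEquality Name
_≟N_ = Sumₚ.≡-dec _≟_ (Sumₚ.≡-dec (Listₚ.≡-dec _≟_) _≟_)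

IsBnd : Name → Set
IsBnd (bnd _) = ⊤
IsBnd _       = ⊥

data Conn : Set where
  conj disj : Conn

_⊙⟨_⟩_ : Set → Conn → Set → Set
A ⊙⟨ conj ⟩ B = A × B
A ⊙⟨ disj ⟩ B = A ⊎ B

⊙-⇔ : ∀ c {A B C D} → A ⇔ B → C ⇔ D → (A ⊙⟨ c ⟩ C) ⇔ (B ⊙⟨ c ⟩ D)
⊙-⇔ conj = _×-⇔_
⊙-⇔ disj = _⊎-⇔_

⊙-comm : ∀ c {A B} → (A ⊙⟨ c ⟩ B) ⇔ (B ⊙⟨ c ⟩ A)
⊙-comm conj = mk⇔ (λ (a , b) → b , a) (λ (b , a) → a , b)
⊙-comm disj = mk⇔ [ inj₂ , inj₁ ] [ inj₂ , inj₁ ]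

_⊙-dec⟨_⟩_ : ∀ {A B} → Dec A → ∀ c → Dec B → Dec (A ⊙⟨ c ⟩ B)
a ⊙-dec⟨ conj ⟩ b = a ×-dec b
a ⊙-dec⟨ disj ⟩ b = a ⊎-dec b

data M : Set where
  mT mF : M
  eE eN eEq eNe : Name → Name → M
  bin : Conn → M → M → M

ren : (Name → Name) → M → M
ren r mT = mT
ren r mF = mF
ren r (eE a b) = eE (r a) (r b)
ren r (eN a b) = eN (r a) (r b)
ren r (eEq a b) = eEq (r a) (r b)
ren r (eNe a b) = eNe (r a) (r b)
ren r (bin c μ ν) = bin c (ren r μ) (ren r ν)

AllN : (Name → Set) → M → Set
AllN P mT = ⊤
AllN P mF = ⊤
AllN P (eE a b) = P a × P b
AllN P (eN a b) = P a × P b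
AllN P (eEq a b) = P a × P b
AllN P (eNe a b) = P a × P b
AllN P (bin c μ ν) = AllN P μ × AllN P ν

AllN-map : ∀ {P R : Name → Set} → (∀ u → P u → R u) → ∀ μ → AllN P μ → AllN R μ
AllN-map f mT h = tt
AllN-map f mF h = tt
AllN-map f (eE a b) (p , q) = f a p , f b q
AllN-map f (eN a b) (p , q) = f a p , f b q
AllN-map f (eEq a b) (p , q) = f a p , f b q
AllN-map f (eNe a b) (p , q) = f a p , f b q
AllN-map f (bin c μ ν) (p , q) = AllN-map f μ p , AllN-map f ν q

AllN-all : ∀ {P : Name → Set} → (∀ u → P u) → ∀ μ → AllN P μ
AllN-all f mT = tt
AllN-all f mF = tt
AllN-all f (eE a b) = f a , f b
AllN-all f (eN a b) = f a , f b
AllN-all f (eEq a b) = f a , f b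
AllN-all f (eNe a b) = f a , f b
AllN-all f (bin c μ ν) = AllN-all f μ , AllN-all f ν

AllN-ren : ∀ {P : Name → Set} r μ → AllN (λ u → P (r u)) μ → AllN P (ren r μ)
AllN-ren r mT h = tt
AllN-ren r mF h = tt
AllN-ren r (eE a b) h = h
AllN-ren r (eN a b) h = h
AllN-ren r (eEq a b) h = h
AllN-ren r (eNe a b) h = h
AllN-ren r (bin c μ ν) (p , q) = AllN-ren r μ p , AllN-ren r ν q

AllN-ren-map : ∀ {P R : Name → Set} r → (∀ u → P u → R (r u)) → ∀ μ → AllN P μ → AllN R (ren r μ)
AllN-ren-map r f μ h = AllN-ren r μ (AllN-map f μ h)

-- A prefix: a list of quantified names, outermost first.
Prefix : Set
Prefix = List (Q × Name)

nm : Prefix → List Name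
nm = map proj₂

mapN : (Name → Name) → Prefix → Prefix
mapN r = map (λ (z , v) → z , r v)

module Sem {n : ℕ} (G : Graph n) where

  Env : Set
  Env = Name → Fin n

  upd : Env → Name → Fin n → Env
  upd ρ v a u with u ≟N v
  ... | yes _ = a
  ... | no _  = ρ u

  upd-hit : ∀ ρ v a → upd ρ v a v ≡ a
  upd-hit ρ v a with v ≟N v
  ... | yes _ = refl
  ... | no ne = contradiction refl ne

  upd-miss : ∀ ρ v a u → u ≢ v → upd ρ v a u ≡ ρ u
  upd-miss ρ v a u ne with u ≟N v
  ... | yes e = contradiction e ne
  ... | no _  = refl

  upd-cong : ∀ ρ ρ' v a u → ρ u ≡ ρ' u → upd ρ v a u ≡ upd ρ' v a u
  upd-cong ρ ρ' v a u e with u ≟N v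
  ... | yes _ = refl
  ... | no _  = e

  Quant : Q → (Fin n → Set) → Set
  Quant ∃Q P = Σ (Fin n) P
  Quant ∀Q P = (a : Fin n) → P a

  Quant-⇔ : ∀ z {P R : Fin n → Set} → (∀ a → P a ⇔ R a) → Quant z P ⇔ Quant z R
  Quant-⇔ ∃Q = Σ-⇔
  Quant-⇔ ∀Q = Π-⇔

  Quant-dec : ∀ z {P : Fin n → Set} → (∀ a → Dec (P a)) → Dec (Quant z P)
  Quant-dec ∃Q = Finₚ.any?
  Quant-dec ∀Q = Finₚ.all?

  QuantOn : Q → (Fin n → Set) → (Fin n → Set) → Set
  QuantOn z F P = Quant z (λ a → Guarded z (F a) (P a))

  QuantOn-⇔ : ∀ z {F F' P R : Fin n → Set} → (∀ a → F a ⇔ F' a) → (∀ a → F a → P a ⇔ R a) →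
              QuantOn z F P ⇔ QuantOn z F' R
  QuantOn-⇔ z hF hP = Quant-⇔ z (λ a → Guarded-⇔ z (hF a) (hP a))

  QuantOn-body-⇔ : ∀ z {F P R : Fin n → Set} → (∀ a → P a ⇔ R a) → QuantOn z F P ⇔ QuantOn z F R
  QuantOn-body-⇔ z h = QuantOn-⇔ z (λ _ → ⇔.refl) (λ a _ → h a)

  QuantOn-const : ∀ z {F : Fin n → Set} {C : Set} → Σ (Fin n) F → QuantOn z F (λ _ → C) ⇔ C
  QuantOn-const ∃Q (a , f) = mk⇔ (λ (_ , _ , c) → c) (λ c → a , f , c)
  QuantOn-const ∀Q (a , f) = mk⇔ (λ g → g a f) (λ c _ _ → c)

  -- Over a nonempty domain a quantifier can be pulled out of one argument
  -- of a connective when the other argument does not depend on it.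
  pullˡ : ∀ z c {P : Fin n → Set} {C : Set} → Fin n → Dec C →
          Quant z (λ a → P a ⊙⟨ c ⟩ C) ⇔ (Quant z P ⊙⟨ c ⟩ C)
  pullˡ ∃Q conj a₀ _ = mk⇔ (λ (a , p , c) → (a , p) , c) (λ ((a , p) , c) → a , p , c)
  pullˡ ∃Q disj a₀ _ =
    mk⇔ (λ { (a , inj₁ p) → inj₁ (a , p) ; (a , inj₂ c) → inj₂ c })
        [ (λ (a , p) → a , inj₁ p) , (λ c → a₀ , inj₂ c) ]
  pullˡ ∀Q conj a₀ _ = mk⇔ (λ f → (λ a → proj₁ (f a)) , proj₂ (f a₀)) (λ (f , c) a → f a , c)
  pullˡ ∀Q disj a₀ (yes c) = mk⇔ (λ _ → inj₂ c) [ (λ f a → inj₁ (f a)) , (λ c a → inj₂ c) ]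
  pullˡ ∀Q disj a₀ (no ¬c) =
    mk⇔ (λ f → inj₁ (λ a → [ (λ p → p) , (λ c → contradiction c ¬c) ] (f a)))
        [ (λ f a → inj₁ (f a)) , (λ c a → inj₂ c) ]

  pullʳ : ∀ z c {P : Fin n → Set} {C : Set} → Fin n → Dec C →
          Quant z (λ a → C ⊙⟨ c ⟩ P a) ⇔ (C ⊙⟨ c ⟩ Quant z P)
  pullʳ z c a₀ d =
    ⇔.trans (Quant-⇔ z (λ _ → ⊙-comm c)) (⇔.trans (pullˡ z c a₀ d) (⊙-comm c))

  ⟦_⟧ : M → Env → Set
  ⟦ mT ⟧ ρ = ⊤
  ⟦ mF ⟧ ρ = ⊥
  ⟦ eE a b ⟧ ρ = E G (ρ a) (ρ b) ≡ true
  ⟦ eN a b ⟧ ρ = E G (ρ a) (ρ b) ≡ false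
  ⟦ eEq a b ⟧ ρ = ρ a ≡ ρ b
  ⟦ eNe a b ⟧ ρ = ρ a ≢ ρ b
  ⟦ bin c μ ν ⟧ ρ = ⟦ μ ⟧ ρ ⊙⟨ c ⟩ ⟦ ν ⟧ ρ

  ⟦⟧-dec : ∀ μ ρ → Dec (⟦ μ ⟧ ρ)
  ⟦⟧-dec mT ρ = yes tt
  ⟦⟧-dec mF ρ = no (λ ())
  ⟦⟧-dec (eE a b) ρ = E G (ρ a) (ρ b) ≟B true
  ⟦⟧-dec (eN a b) ρ = E G (ρ a) (ρ b) ≟B false
  ⟦⟧-dec (eEq a b) ρ = ρ a ≟F ρ b
  ⟦⟧-dec (eNe a b) ρ = ¬? (ρ a ≟F ρ b)
  ⟦⟧-dec (bin c μ ν) ρ = ⟦⟧-dec μ ρ ⊙-dec⟨ c ⟩ ⟦⟧-dec ν ρ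

  ⟦⟧-ren : ∀ r μ ρ → ⟦ ren r μ ⟧ ρ ⇔ ⟦ μ ⟧ (λ u → ρ (r u))
  ⟦⟧-ren r mT ρ = ⇔.refl
  ⟦⟧-ren r mF ρ = ⇔.refl
  ⟦⟧-ren r (eE a b) ρ = ⇔.refl
  ⟦⟧-ren r (eN a b) ρ = ⇔.refl
  ⟦⟧-ren r (eEq a b) ρ = ⇔.refl
  ⟦⟧-ren r (eNe a b) ρ = ⇔.refl
  ⟦⟧-ren r (bin c μ ν) ρ = ⊙-⇔ c (⟦⟧-ren r μ ρ) (⟦⟧-ren r ν ρ)

  ⟦⟧-coin : ∀ μ ρ ρ' → AllN (λ u → ρ u ≡ ρ' u) μ → ⟦ μ ⟧ ρ ⇔ ⟦ μ ⟧ ρ'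
  ⟦⟧-coin mT ρ ρ' h = ⇔.refl
  ⟦⟧-coin mF ρ ρ' h = ⇔.refl
  ⟦⟧-coin (eE a b) ρ ρ' (p , q) rewrite p | q = ⇔.refl
  ⟦⟧-coin (eN a b) ρ ρ' (p , q) rewrite p | q = ⇔.refl
  ⟦⟧-coin (eEq a b) ρ ρ' (p , q) rewrite p | q = ⇔.refl
  ⟦⟧-coin (eNe a b) ρ ρ' (p , q) rewrite p | q = ⇔.refl
  ⟦⟧-coin (bin c μ ν) ρ ρ' (p , q) = ⊙-⇔ c (⟦⟧-coin μ ρ ρ' p) (⟦⟧-coin ν ρ ρ' q)

  PSat : Env → Prefix → M → Set
  PSat ρ [] μ = ⟦ μ ⟧ ρ
  PSat ρ ((z , v) ∷ L) μ = Quant z (λ a → PSat (upd ρ v a) L μ)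

  PSat-dec : ∀ ρ L μ → Dec (PSat ρ L μ)
  PSat-dec ρ [] μ = ⟦⟧-dec μ ρ
  PSat-dec ρ ((z , v) ∷ L) μ = Quant-dec z (λ a → PSat-dec (upd ρ v a) L μ)

  PSat-coin : ∀ L μ ρ ρ' → AllN (λ u → u ∈ nm L ⊎ ρ u ≡ ρ' u) μ → PSat ρ L μ ⇔ PSat ρ' L μ
  PSat-coin [] μ ρ ρ' h = ⟦⟧-coin μ ρ ρ' (AllN-map (λ u → [ (λ ()) , (λ e → e) ]) μ h)
  PSat-coin ((z , v) ∷ L) μ ρ ρ' h = Quant-⇔ z (λ a → PSat-coin L μ _ _ (AllN-map (step a) μ h))
    where
    step : ∀ a u → u ∈ nm ((z , v) ∷ L) ⊎ ρ u ≡ ρ' u → u ∈ nm L ⊎ upd ρ v a u ≡ upd ρ' v a u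
    step a u (inj₁ (here refl)) = inj₂ (trans (upd-hit ρ v a) (sym (upd-hit ρ' v a)))
    step a u (inj₁ (there m))   = inj₁ m
    step a u (inj₂ e)           = inj₂ (upd-cong ρ ρ' v a u e)

  PSat-ext : ∀ L μ ρ ρ' → (∀ u → ρ u ≡ ρ' u) → PSat ρ L μ ⇔ PSat ρ' L μ
  PSat-ext L μ ρ ρ' e = PSat-coin L μ ρ ρ' (AllN-all (λ u → inj₂ (e u)) μ)

  PSat-ren : ∀ r L μ ρ → (∀ v → v ∈ nm L → ∀ u → r u ≡ r v → u ≡ v) →
             PSat ρ (mapN r L) (ren r μ) ⇔ PSat (λ u → ρ (r u)) L μ
  PSat-ren r [] μ ρ inj = ⟦⟧-ren r μ ρ
  PSat-ren r ((z , v) ∷ L) μ ρ inj = Quant-⇔ z step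
    where
    pt : ∀ a u → upd ρ (r v) a (r u) ≡ upd (λ w → ρ (r w)) v a u
    pt a u with u ≟N v
    ... | yes refl = upd-hit ρ (r v) a
    ... | no ne    = upd-miss ρ (r v) a (r u) (λ e → ne (inj v (here refl) u e))
    step : ∀ a → PSat (upd ρ (r v) a) (mapN r L) (ren r μ) ⇔ PSat (upd (λ w → ρ (r w)) v a) L μ
    step a = ⇔.trans (PSat-ren r L μ (upd ρ (r v) a) (λ w m → inj w (there m)))
                     (PSat-ext L μ _ _ (pt a))

module _ {A : Set} where

  interleave-∈ˡ : ∀ {xs ys zs : List A} {x} → Interleaving xs ys zs → x ∈ xs → x ∈ zs
  interleave-∈ˡ (consˡ s) (here e)  = here e
  interleave-∈ˡ (consˡ s) (there m) = there (interleave-∈ˡ s m)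
  interleave-∈ˡ (consʳ s) m         = there (interleave-∈ˡ s m)

  interleave-∈ʳ : ∀ {xs ys zs : List A} {y} → Interleaving xs ys zs → y ∈ ys → y ∈ zs
  interleave-∈ʳ (consˡ s) m         = there (interleave-∈ʳ s m)
  interleave-∈ʳ (consʳ s) (here e)  = here e
  interleave-∈ʳ (consʳ s) (there m) = there (interleave-∈ʳ s m)

  interleave-All : ∀ {P : A → Set} {xs ys zs} → Interleaving xs ys zs → All P xs → All P ys → All P zs
  interleave-All []        []       []       = []
  interleave-All (consˡ s) (p ∷ ps) qs       = p ∷ interleave-All s ps qs
  interleave-All (consʳ s) ps       (q ∷ qs) = q ∷ interleave-All s ps qs

  interleave-unique : ∀ {xs ys zs : List A} → Interleaving xs ys zs → Unique xs → Unique ys →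
                      All (λ x → All (x ≢_) ys) xs → Unique zs
  interleave-unique [] _ _ _ = []
  interleave-unique (consˡ s) (x∉xs ∷ uxs) uys (x∉ys ∷ d) =
    interleave-All s x∉xs x∉ys ∷ interleave-unique s uxs uys d
  interleave-unique (consʳ s) uxs (y∉ys ∷ uys) d =
    interleave-All s (All.map (λ h → ≢-sym (All.head h)) d) y∉ys
      ∷ interleave-unique s uxs uys (All.map All.tail d)

  interleave-++ : ∀ (xs ys : List A) {l r zs} → Interleaving l r zs →
                  Interleaving (xs ++ l) (ys ++ r) (xs ++ ys ++ zs)
  interleave-++ (x ∷ xs) ys       s = consˡ (interleave-++ xs ys s)
  interleave-++ []       (y ∷ ys) s = consʳ (interleave-++ [] ys s)
  interleave-++ []       []       s = s

module Commute {n : ℕ} (G : Graph n) where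
  open Sem G

  frame : ∀ L μ ρ v a → AllN (_≢ v) μ → PSat (upd ρ v a) L μ ⇔ PSat ρ L μ
  frame L μ ρ v a h = PSat-coin L μ _ _ (AllN-map (λ u ne → inj₂ (upd-miss ρ v a u ne)) μ h)

  comb : ∀ c {LA LB L} → Interleaving LA LB L → ∀ μA μB ρ →
         AllN (_∉ nm LA) μB → AllN (_∉ nm LB) μA →
         PSat ρ L (bin c μA μB) ⇔ (PSat ρ LA μA ⊙⟨ c ⟩ PSat ρ LB μB)
  comb c [] μA μB ρ hB hA = ⇔.refl
  comb c {(z , v) ∷ LA} {LB} {_ ∷ L} (consˡ s) μA μB ρ hB hA =
    ⇔.trans (Quant-⇔ z step) (pullˡ z c (ρ v) (PSat-dec ρ LB μB))
    where
    step : ∀ a → PSat (upd ρ v a) L (bin c μA μB) ⇔ (PSat (upd ρ v a) LA μA ⊙⟨ c ⟩ PSat ρ LB μB)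
    step a = ⇔.trans (comb c s μA μB (upd ρ v a) (AllN-map (λ u h m → h (there m)) μB hB) hA)
                     (⊙-⇔ c ⇔.refl (frame LB μB ρ v a (AllN-map (λ u h e → h (here e)) μB hB)))
  comb c {LA} {(z , v) ∷ LB} {_ ∷ L} (consʳ s) μA μB ρ hB hA =
    ⇔.trans (Quant-⇔ z step) (pullʳ z c (ρ v) (PSat-dec ρ LA μA))
    where
    step : ∀ a → PSat (upd ρ v a) L (bin c μA μB) ⇔ (PSat ρ LA μA ⊙⟨ c ⟩ PSat (upd ρ v a) LB μB)
    step a = ⇔.trans (comb c s μA μB (upd ρ v a) hB (AllN-map (λ u h m → h (there m)) μA hA))
                     (⊙-⇔ c (frame LA μA ρ v a (AllN-map (λ u h e → h (here e)) μA hA)) ⇔.refl)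

Blk : ℕ → Set
Blk K = Vec (List Name) K

flat : ∀ {K} → Q → Blk K → Prefix
flat s [] = []
flat s (B ∷ Bs) = map (s ,_) B ++ flat (flipQ s) Bs

allNames : ∀ {K} → Blk K → List Name
allNames [] = []
allNames (B ∷ Bs) = B ++ allNames Bs

emptyBlk : ∀ K → Blk K
emptyBlk K = Vec.replicate K []

mapB : ∀ {K} → (Name → Name) → Blk K → Blk K
mapB r = Vec.map (map r)

zipB : ∀ {K} → Blk K → Blk K → Blk K
zipB = Vec.zipWith _++_

nm-map : ∀ s (B : List Name) → nm (map (s ,_) B) ≡ B
nm-map s B = trans (sym (Listₚ.map-∘ B)) (Listₚ.map-id B)

nm-flat : ∀ {K} s (Bs : Blk K) → nm (flat s Bs) ≡ allNames Bs
nm-flat s [] = refl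
nm-flat s (B ∷ Bs) =
  trans (Listₚ.map-++ proj₂ (map (s ,_) B) _) (cong₂ _++_ (nm-map s B) (nm-flat (flipQ s) Bs))

flat-mapB : ∀ {K} r s (Bs : Blk K) → flat s (mapB r Bs) ≡ mapN r (flat s Bs)
flat-mapB r s [] = refl
flat-mapB r s (B ∷ Bs) =
  trans (cong₂ _++_ (trans (sym (Listₚ.map-∘ B)) (Listₚ.map-∘ B)) (flat-mapB r (flipQ s) Bs))
        (sym (Listₚ.map-++ _ (map (s ,_) B) _))

nm-blocks : ∀ {K} s B (Bs : Blk K) → nm (map (s ,_) B ++ flat (flipQ s) Bs) ≡ B ++ allNames Bs
nm-blocks s B Bs = nm-flat s (B ∷ Bs)

allNames-mapB : ∀ {K} r (Bs : Blk K) → allNames (mapB r Bs) ≡ map r (allNames Bs)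
allNames-mapB r [] = refl
allNames-mapB r (B ∷ Bs) = trans (cong (map r B ++_) (allNames-mapB r Bs)) (sym (Listₚ.map-++ r B _))

flat-zipB : ∀ {K} s (As Bs : Blk K) → Interleaving (flat s As) (flat s Bs) (flat s (zipB As Bs))
flat-zipB s [] [] = []
flat-zipB s (A ∷ As) (B ∷ Bs) =
  subst (Interleaving _ _)
        (sym (trans (cong (_++ _) (Listₚ.map-++ (s ,_) A B)) (Listₚ.++-assoc (map (s ,_) A) _ _)))
        (interleave-++ (map (s ,_) A) (map (s ,_) B) (flat-zipB (flipQ s) As Bs))

allNames-zipB : ∀ {K} (As Bs : Blk K) → Interleaving (allNames As) (allNames Bs) (allNames (zipB As Bs))
allNames-zipB [] [] = []
allNames-zipB (A ∷ As) (B ∷ Bs) =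
  subst (Interleaving _ _) (sym (Listₚ.++-assoc A B _)) (interleave-++ A B (allNames-zipB As Bs))

flat-empty : ∀ K s → flat s (emptyBlk K) ≡ []
flat-empty zero s = refl
flat-empty (suc K) s = flat-empty K (flipQ s)

allNames-empty : ∀ K → allNames (emptyBlk K) ≡ []
allNames-empty zero = refl
allNames-empty (suc K) = allNames-empty K

WellNamed : ∀ {K} → Blk K → Set
WellNamed Bs = All IsBnd (allNames Bs) × Unique (allNames Bs)

emptyBlk-wellNamed : ∀ K → WellNamed (emptyBlk K)
emptyBlk-wellNamed K rewrite allNames-empty K = [] , []

-- Tags make the bound names of the two sides of a connective disjoint.
tag : ℕ → Name → Name
tag i (bnd p) = bnd (i ∷ p)
tag i u       = u

untag : Name → Name
untag (bnd (_ ∷ p)) = bnd p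
untag u             = u

tag-injective : ∀ i {u v} → tag i u ≡ tag i v → u ≡ v
tag-injective i = retraction⇒injective (tag i) untag untag-tag
  where
  untag-tag : ∀ u → untag (tag i u) ≡ u
  untag-tag (free x)   = refl
  untag-tag (bnd p)    = refl
  untag-tag (outVar j) = refl

tag-bnd : ∀ i u → IsBnd u → IsBnd (tag i u)
tag-bnd i (bnd p) _ = tt

tag-apart : ∀ i j → i ≢ j → ∀ u v → IsBnd v → tag i u ≢ tag j v
tag-apart i j i≢j (bnd p) (bnd q) _ refl = i≢j refl

tag-∉ : ∀ i j → i ≢ j → ∀ u {vs} → All IsBnd vs → tag i u ∉ map (tag j) vs
tag-∉ i j i≢j u bs m with ∈-map⁻ (tag j) m
... | v , v∈ , e = tag-apart i j i≢j u v (All.lookup bs v∈) e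

combine : ∀ {K} → Conn → Blk K × M → Blk K × M → Blk K × M
combine c (As , μA) (Bs , μB) =
  zipB (mapB (tag 1) As) (mapB (tag 2) Bs) , bin c (ren (tag 1) μA) (ren (tag 2) μB)

combine-names : ∀ {K} (As Bs : Blk K) →
  Interleaving (map (tag 1) (allNames As)) (map (tag 2) (allNames Bs))
               (allNames (zipB (mapB (tag 1) As) (mapB (tag 2) Bs)))
combine-names As Bs =
  subst₂ (λ X Y → Interleaving X Y (allNames (zipB (mapB (tag 1) As) (mapB (tag 2) Bs))))
         (allNames-mapB (tag 1) As) (allNames-mapB (tag 2) Bs)
         (allNames-zipB (mapB (tag 1) As) (mapB (tag 2) Bs))

combine-wellNamed : ∀ {K} c (rA rB : Blk K × M) → WellNamed (proj₁ rA) → WellNamed (proj₁ rB) →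
                    WellNamed (proj₁ (combine c rA rB))
combine-wellNamed c (As , _) (Bs , _) (bA , uA) (bB , uB) =
  interleave-All (combine-names As Bs) (tagged 1 bA) (tagged 2 bB) ,
  interleave-unique (combine-names As Bs)
    (Uniqueₚ.map⁺ (tag-injective 1) uA) (Uniqueₚ.map⁺ (tag-injective 2) uB)
    (Allₚ.map⁺ (All.tabulate (λ {u} _ → Allₚ.¬Any⇒All¬ _ (tag-∉ 1 2 (λ ()) u bB))))
  where
  tagged : ∀ i {vs} → All IsBnd vs → All IsBnd (map (tag i) vs)
  tagged i bs = Allₚ.map⁺ (All.map (λ {u} → tag-bnd i u) bs)

Scope : (Name → Set) → List Name → Name → Set
Scope P ns (free x)   = P (free x)
Scope P ns (bnd p)    = bnd p ∈ ns
Scope P ns (outVar j) = P (outVar j)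

Scoped : ∀ {K} → (Name → Set) → Blk K × M → Set
Scoped P (Bs , μ) = WellNamed Bs × AllN (Scope P (allNames Bs)) μ

Scoped-mono : ∀ {K} {P R : Name → Set} (r : Blk K × M) → (∀ u → P u → R u) → Scoped P r → Scoped R r
Scoped-mono {P = P} {R} (Bs , μ) f (w , sc) = w , AllN-map weaken μ sc
  where
  weaken : ∀ u → Scope P (allNames Bs) u → Scope R (allNames Bs) u
  weaken (free y)   p = f _ p
  weaken (bnd p)    m = m
  weaken (outVar j) p = f _ p

combine-scoped : ∀ {K} c (rA rB : Blk K × M) {PA PB R : Name → Set} →
  (∀ u → PA u → R u) → (∀ u → PB u → R u) → Scoped PA rA → Scoped PB rB → Scoped R (combine c rA rB)
combine-scoped c rA@(As , μA) rB@(Bs , μB) {PA} {PB} {R} fA fB (wA , sA) (wB , sB) =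
  combine-wellNamed c rA rB wA wB , AllN-ren-map (tag 1) scopeA μA sA , AllN-ren-map (tag 2) scopeB μB sB
  where
  scopeA : ∀ u → Scope PA (allNames As) u → Scope R (allNames (proj₁ (combine c rA rB))) (tag 1 u)
  scopeA (free y)   p = fA _ p
  scopeA (bnd p)    m = interleave-∈ˡ (combine-names As Bs) (∈-map⁺ (tag 1) m)
  scopeA (outVar j) p = fA _ p
  scopeB : ∀ u → Scope PB (allNames Bs) u → Scope R (allNames (proj₁ (combine c rA rB))) (tag 2 u)
  scopeB (free y)   p = fB _ p
  scopeB (bnd p)    m = interleave-∈ʳ (combine-names As Bs) (∈-map⁺ (tag 2) m)
  scopeB (outVar j) p = fB _ p

module CombineSem {n : ℕ} (G : Graph n) where
  open Sem G
  open Commute G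

  avoids : ∀ {K} i j → i ≢ j → ∀ s (As : Blk K) μ → All IsBnd (allNames As) →
           AllN (_∉ nm (flat s (mapB (tag j) As))) (ren (tag i) μ)
  avoids i j i≢j s As μ bs =
    AllN-ren (tag i) μ (AllN-all (λ u m → tag-∉ i j i≢j u bs (subst (tag i u ∈_) eq m)) μ)
    where
    eq : nm (flat s (mapB (tag j) As)) ≡ map (tag j) (allNames As)
    eq = trans (nm-flat s (mapB (tag j) As)) (allNames-mapB (tag j) As)

  untagged : ∀ {K} i s (As : Blk K) μ ρ →
             PSat ρ (flat s (mapB (tag i) As)) (ren (tag i) μ) ⇔ PSat (λ u → ρ (tag i u)) (flat s As) μ
  untagged i s As μ ρ rewrite flat-mapB (tag i) s As =
    PSat-ren (tag i) (flat s As) μ ρ (λ v _ u → tag-injective i)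

  combine-sem : ∀ {K} c s (As Bs : Blk K) μA μB ρ → All IsBnd (allNames As) → All IsBnd (allNames Bs) →
    PSat ρ (flat s (proj₁ (combine c (As , μA) (Bs , μB)))) (proj₂ (combine c (As , μA) (Bs , μB)))
      ⇔ (PSat (λ u → ρ (tag 1 u)) (flat s As) μA ⊙⟨ c ⟩ PSat (λ u → ρ (tag 2 u)) (flat s Bs) μB)
  combine-sem c s As Bs μA μB ρ bA bB =
    ⇔.trans (comb c (flat-zipB s (mapB (tag 1) As) (mapB (tag 2) Bs)) _ _ ρ
                  (avoids 2 1 (λ ()) s As μB bA) (avoids 1 2 (λ ()) s Bs μA bB))
            (⊙-⇔ c (untagged 1 s As μA ρ) (untagged 2 s Bs μB ρ))

sub : ℕ → Name → Name
sub x (free y) with y ≟ x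
... | yes _ = bnd []
... | no _  = free y
sub x (bnd p)    = bnd (0 ∷ p)
sub x (outVar j) = outVar j

sub-injective : ∀ x {u v} → sub x u ≡ sub x v → u ≡ v
sub-injective x = retraction⇒injective (sub x) unsub unsub-sub
  where
  unsub : Name → Name
  unsub (bnd [])      = free x
  unsub (bnd (_ ∷ p)) = bnd p
  unsub u             = u
  unsub-sub : ∀ u → unsub (sub x u) ≡ u
  unsub-sub (free y) with y ≟ x
  ... | yes refl = refl
  ... | no _     = refl
  unsub-sub (bnd p)    = refl
  unsub-sub (outVar j) = refl

consHead : ∀ {K} → Name → Blk (suc K) → Blk (suc K)
consHead v (B ∷ Bs) = (v ∷ B) ∷ Bs

bindHead : ∀ {K} → ℕ → Blk (suc K) × M → Blk (suc K) × M
bindHead x (Bs , μ) = consHead (bnd []) (mapB (sub x) Bs) , ren (sub x) μ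

-- pren s K ψ: K alternating blocks, the first one quantified by s, and a
-- matrix.  It is correct when ψ has fewer than K label changes below s.
mutual
  pren : Q → (K : ℕ) → Form → Blk K × M
  pren s K (x ∼ y)  = emptyBlk K , eE (free x) (free y)
  pren s K (x ≁ y)  = emptyBlk K , eN (free x) (free y)
  pren s K (x == y) = emptyBlk K , eEq (free x) (free y)
  pren s K (x ≠ y)  = emptyBlk K , eNe (free x) (free y)
  pren s K (φ ∧ ψ)  = combine conj (pren s K φ) (pren s K ψ)
  pren s K (φ ∨ ψ)  = combine disj (pren s K φ) (pren s K ψ)
  pren s K (quant z x ψ) = prenQ s K z x ψ (z ≟Q s)

  -- The cases K = 0 and K = 1 with a change of kind exceed the budget.
  prenQ : (s : Q) → (K : ℕ) → (z : Q) → ℕ → Form → Dec (z ≡ s) → Blk K × M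
  prenQ s zero z x ψ d = [] , mT
  prenQ s (suc K) z x ψ (yes _) = bindHead x (pren s (suc K) ψ)
  prenQ s (suc zero) z x ψ (no _) = [] ∷ [] , mT
  prenQ s (suc (suc K)) z x ψ (no _) =
    [] ∷ proj₁ (bindHead x (pren z (suc K) ψ)) , proj₂ (bindHead x (pren z (suc K) ψ))

FreeVar : Form → Name → Set
FreeVar ψ (free y) = FreeIn y ψ
FreeVar ψ _        = ⊥

FreeVar-mono : ∀ {φ ψ} → (∀ {y} → FreeIn y φ → FreeIn y ψ) → ∀ u → FreeVar φ u → FreeVar ψ u
FreeVar-mono f (free y) fi = f fi

Prenexed : ∀ {K} → Form → Blk K × M → Set
Prenexed ψ = Scoped (FreeVar ψ)

allNames-bindHead : ∀ {K} x (r : Blk (suc K) × M) →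
                    allNames (proj₁ (bindHead x r)) ≡ bnd [] ∷ map (sub x) (allNames (proj₁ r))
allNames-bindHead x (B ∷ Bs , μ) =
  cong (bnd [] ∷_) (trans (cong (map (sub x) B ++_) (allNames-mapB (sub x) Bs))
                          (sym (Listₚ.map-++ (sub x) B _)))

-- Binding x keeps the names distinct (the new name bnd [] differs from all
-- renamed ones) and turns the free variable x into that bound name.
bindHead-prenexed : ∀ {K} z x ψ (r : Blk (suc K) × M) → Prenexed ψ r → Prenexed (quant z x ψ) (bindHead x r)
bindHead-prenexed z x ψ r ((bs , u) , sc) rewrite allNames-bindHead x r =
  (tt ∷ Allₚ.map⁺ (All.map (λ {v} → stillBound v) bs) ,
   Allₚ.map⁺ (All.tabulate (λ {v} m → new v (All.lookup bs m))) ∷ Uniqueₚ.map⁺ (sub-injective x) u) ,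
  AllN-ren-map (sub x) scope (proj₂ r) sc
  where
  stillBound : ∀ v → IsBnd v → IsBnd (sub x v)
  stillBound (bnd p) _ = tt
  new : ∀ v → IsBnd v → bnd [] ≢ sub x v
  new (bnd p) _ ()
  scope : ∀ u → Scope (FreeVar ψ) (allNames (proj₁ r)) u →
          Scope (FreeVar (quant z x ψ)) (bnd [] ∷ map (sub x) (allNames (proj₁ r))) (sub x u)
  scope (free y) fi with y ≟ x
  ... | yes _ = here refl
  ... | no ne = fQ ne fi
  scope (bnd p) m = there (∈-map⁺ (sub x) m)

mutual
  pren-prenexed : ∀ ψ s K → Prenexed ψ (pren s K ψ)
  pren-prenexed (x ∼ y) s K  = emptyBlk-wellNamed K , f∼ˡ , f∼ʳ
  pren-prenexed (x ≁ y) s K  = emptyBlk-wellNamed K , f≁ˡ , f≁ʳ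
  pren-prenexed (x == y) s K = emptyBlk-wellNamed K , f=ˡ , f=ʳ
  pren-prenexed (x ≠ y) s K  = emptyBlk-wellNamed K , f≠ˡ , f≠ʳ
  pren-prenexed (φ ∧ ψ) s K =
    combine-scoped conj (pren s K φ) (pren s K ψ) (FreeVar-mono f∧ˡ) (FreeVar-mono f∧ʳ)
                   (pren-prenexed φ s K) (pren-prenexed ψ s K)
  pren-prenexed (φ ∨ ψ) s K =
    combine-scoped disj (pren s K φ) (pren s K ψ) (FreeVar-mono f∨ˡ) (FreeVar-mono f∨ʳ)
                   (pren-prenexed φ s K) (pren-prenexed ψ s K)
  pren-prenexed (quant z x ψ) s K = prenQ-prenexed s K z x ψ (z ≟Q s)

  prenQ-prenexed : ∀ s K z x ψ d → Prenexed (quant z x ψ) (prenQ s K z x ψ d)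
  prenQ-prenexed s zero z x ψ d = ([] , []) , tt
  prenQ-prenexed s (suc K) z x ψ (yes _) =
    bindHead-prenexed z x ψ (pren s (suc K) ψ) (pren-prenexed ψ s (suc K))
  prenQ-prenexed s (suc zero) z x ψ (no _) = ([] , []) , tt
  prenQ-prenexed s (suc (suc K)) z x ψ (no _) =
    bindHead-prenexed z x ψ (pren z (suc K) ψ) (pren-prenexed ψ z (suc K))

chChildren-++ : ∀ s Φ Ψ → chChildren s (Φ ++ Ψ) ≡ chChildren s Φ ⊔ chChildren s Ψ
chChildren-++ s [] Ψ = refl
chChildren-++ s (node w us ∷ Φ) Ψ =
  trans (cong ((diff s w + chChildren w us) ⊔_) (chChildren-++ s Φ Ψ))
        (sym (⊔-assoc (diff s w + chChildren w us) _ _))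

budget-split : ∀ s Φ Ψ {K} → chChildren s (Φ ++ Ψ) < K → chChildren s Φ < K × chChildren s Ψ < K
budget-split s Φ Ψ {K} b =
  m⊔n≤o⇒m≤o (suc (chChildren s Φ)) (suc (chChildren s Ψ)) b' ,
  m⊔n≤o⇒n≤o (suc (chChildren s Φ)) (suc (chChildren s Ψ)) b'
  where b' = subst (λ t → suc t ≤ K) (chChildren-++ s Φ Ψ) b

budget-same : ∀ s c {K} → (diff s s + c) ⊔ 0 < K → c < K
budget-same ∃Q c {K} b = subst (_< K) (⊔-identityʳ c) b
budget-same ∀Q c {K} b = subst (_< K) (⊔-identityʳ c) b

budget-other : ∀ {s z} c {K} → z ≢ s → (diff s z + c) ⊔ 0 < K → suc c < K
budget-other {∃Q} {∃Q} c z≢s b = contradiction refl z≢s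
budget-other {∃Q} {∀Q} c {K} z≢s b = subst (_< K) (⊔-identityʳ (suc c)) b
budget-other {∀Q} {∃Q} c {K} z≢s b = subst (_< K) (⊔-identityʳ (suc c)) b
budget-other {∀Q} {∀Q} c z≢s b = contradiction refl z≢s

≢⇒flip : ∀ {z s} → z ≢ s → z ≡ flipQ s
≢⇒flip {∃Q} {∃Q} z≢s = contradiction refl z≢s
≢⇒flip {∃Q} {∀Q} z≢s = refl
≢⇒flip {∀Q} {∃Q} z≢s = refl
≢⇒flip {∀Q} {∀Q} z≢s = contradiction refl z≢s

module PrenexSem {n : ℕ} (G : Graph n) where
  open Sem G
  open CombineSem G

  Agree : (ℕ → Fin n) → Env → Set
  Agree ρ τ = ∀ y → τ (free y) ≡ ρ y

  Sat-quant : ∀ z x ψ ρ → Sat G ρ (quant z x ψ) ⇔ Quant z (λ a → Sat G (ρ [ x ↦ a ]) ψ)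
  Sat-quant ∃Q x ψ ρ = ⇔.refl
  Sat-quant ∀Q x ψ ρ = ⇔.refl

  agree-bind : ∀ ρ τ x a → Agree ρ τ → Agree (ρ [ x ↦ a ]) (λ u → upd τ (bnd []) a (sub x u))
  agree-bind ρ τ x a h y with y ≟ x
  ... | yes _ = upd-hit τ (bnd []) a
  ... | no _  = trans (upd-miss τ (bnd []) a (free y) (λ ())) (h y)

  bindHead-sem : ∀ {K} s x (r : Blk (suc K) × M) τ →
    PSat τ (flat s (proj₁ (bindHead x r))) (proj₂ (bindHead x r)) ⇔
    Quant s (λ a → PSat (λ u → upd τ (bnd []) a (sub x u)) (flat s (proj₁ r)) (proj₂ r))
  bindHead-sem s x (B ∷ Bs , μ) τ = Quant-⇔ s renamed
    where
    renamed : ∀ a → PSat (upd τ (bnd []) a) (flat s (mapB (sub x) (B ∷ Bs))) (ren (sub x) μ) ⇔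
                    PSat (λ u → upd τ (bnd []) a (sub x u)) (flat s (B ∷ Bs)) μ
    renamed a rewrite flat-mapB (sub x) s (B ∷ Bs) =
      PSat-ren (sub x) (flat s (B ∷ Bs)) μ (upd τ (bnd []) a) (λ v _ u → sub-injective x)

  atom-sem : ∀ K s μ τ {A : Set} → A ⇔ ⟦ μ ⟧ τ → A ⇔ PSat τ (flat s (emptyBlk K)) μ
  atom-sem K s μ τ h rewrite flat-empty K s = h

  atom-agree : ∀ (P : Fin n → Fin n → Set) x y ρ τ → Agree ρ τ →
               P (ρ x) (ρ y) ⇔ P (τ (free x)) (τ (free y))
  atom-agree P x y ρ τ h rewrite h x | h y = ⇔.refl

  mutual
    pren-sem : ∀ ψ s K → chChildren s (F ψ) < K → ∀ ρ τ → Agree ρ τ →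
               Sat G ρ ψ ⇔ PSat τ (flat s (proj₁ (pren s K ψ))) (proj₂ (pren s K ψ))
    pren-sem (x ∼ y) s K b ρ τ h  = atom-sem K s _ τ (atom-agree (λ a a' → E G a a' ≡ true) x y ρ τ h)
    pren-sem (x ≁ y) s K b ρ τ h  = atom-sem K s _ τ (atom-agree (λ a a' → E G a a' ≡ false) x y ρ τ h)
    pren-sem (x == y) s K b ρ τ h = atom-sem K s _ τ (atom-agree _≡_ x y ρ τ h)
    pren-sem (x ≠ y) s K b ρ τ h  = atom-sem K s _ τ (atom-agree _≢_ x y ρ τ h)
    pren-sem (φ ∧ ψ) s K b ρ τ h = connective-sem conj φ ψ s K b ρ τ h
    pren-sem (φ ∨ ψ) s K b ρ τ h = connective-sem disj φ ψ s K b ρ τ h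
    pren-sem (quant z x ψ) s K b ρ τ h = prenQ-sem s K z x ψ (z ≟Q s) b ρ τ h

    connective-sem : ∀ c φ ψ s K → chChildren s (F φ ++ F ψ) < K → ∀ ρ τ → Agree ρ τ →
      (Sat G ρ φ ⊙⟨ c ⟩ Sat G ρ ψ) ⇔
      PSat τ (flat s (proj₁ (combine c (pren s K φ) (pren s K ψ))))
             (proj₂ (combine c (pren s K φ) (pren s K ψ)))
    connective-sem c φ ψ s K b ρ τ h =
      ⇔.trans (⊙-⇔ c (pren-sem φ s K bφ ρ (λ u → τ (tag 1 u)) h)
                     (pren-sem ψ s K bψ ρ (λ u → τ (tag 2 u)) h))
              (⇔.sym (combine-sem c s As Bs (proj₂ (pren s K φ)) (proj₂ (pren s K ψ)) τ
                                  (proj₁ (proj₁ (pren-prenexed φ s K)))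
                                  (proj₁ (proj₁ (pren-prenexed ψ s K)))))
      where
      As = proj₁ (pren s K φ)
      Bs = proj₁ (pren s K ψ)
      bφ = proj₁ (budget-split s (F φ) (F ψ) b)
      bψ = proj₂ (budget-split s (F φ) (F ψ) b)

    prenQ-sem : ∀ s K z x ψ d → (diff s z + chChildren z (F ψ)) ⊔ 0 < K → ∀ ρ τ → Agree ρ τ →
                Sat G ρ (quant z x ψ) ⇔
                PSat τ (flat s (proj₁ (prenQ s K z x ψ d))) (proj₂ (prenQ s K z x ψ d))
    prenQ-sem s zero z x ψ d () ρ τ h
    prenQ-sem s (suc K) z x ψ (yes refl) b = bind-sem s K x ψ (budget-same s _ b)
    prenQ-sem s (suc zero) z x ψ (no z≢s) b with budget-other _ z≢s b
    ... | s≤s ()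
    prenQ-sem s (suc (suc K)) z x ψ (no z≢s) b with ≢⇒flip z≢s
    ... | refl = bind-sem (flipQ s) K x ψ (≤-pred (budget-other _ z≢s b))

    bind-sem : ∀ s K x ψ → chChildren s (F ψ) < suc K → ∀ ρ τ → Agree ρ τ →
      Sat G ρ (quant s x ψ) ⇔
      PSat τ (flat s (proj₁ (bindHead x (pren s (suc K) ψ)))) (proj₂ (bindHead x (pren s (suc K) ψ)))
    bind-sem s K x ψ b ρ τ h =
      ⇔.trans (Sat-quant s x ψ ρ)
        (⇔.trans (Quant-⇔ s (λ a → pren-sem ψ s (suc K) b (ρ [ x ↦ a ]) _ (agree-bind ρ τ x a h)))
                 (⇔.sym (bindHead-sem s x (pren s (suc K) ψ) τ)))

outVars : ℕ → List Name
outVars k = map outVar (downFrom k)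

outVars-length : ∀ k → length (outVars k) ≡ k
outVars-length k = trans (Listₚ.length-map outVar (downFrom k)) (Listₚ.length-downFrom k)

outVars-< : ∀ {k w} → w ∈ outVars k → Σ ℕ λ j → w ≡ outVar j × j < k
outVars-< w∈ with ∈-map⁻ outVar w∈
... | j , j∈ , e = j , e , ∈-downFrom⁻ j∈

replace : Name → Name → Name → Name
replace v w u with u ≟N v
... | yes _ = w
... | no _  = u

-- Eliminating the quantified name v at stage k: in every matrix, v is
-- either one of the earlier output variables or the new variable c_k.
expand : ℕ → Name → List M → List M
expand k v = Data.List.concatMap (λ μ → map (λ w → ren (replace v w) μ) (outVars (suc k)))

-- A family of matrices is read as a disjunction under ∃ and as a
-- conjunction under ∀.
connOf : Q → Conn
connOf ∃Q = disj
connOf ∀Q = conj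

unitOf : Q → M
unitOf ∃Q = mF
unitOf ∀Q = mT

joinFam : Q → List M → M
joinFam s [] = unitOf s
joinFam s (μ ∷ D) = bin (connOf s) μ (joinFam s D)

-- Merging a family D, all under the same blocks Bs, into one prenexed
-- matrix (each member gets its own tagged copy of the bound names).
mergeFam : ∀ {K} → Q → List M → Blk K → Blk K × M
mergeFam {K} s [] Bs = emptyBlk K , unitOf s
mergeFam s (μ ∷ D) Bs = combine (connOf s) (Bs , μ) (mergeFam s D Bs)

-- elimEq k s B K Bs D: the family D under the rest B of the current block
-- (kind s) and K further blocks Bs becomes the quantifier kinds of the
-- output prefix on c_k, c_{k+1}, … together with the output matrix.
mutual
  elimEq : ℕ → Q → List Name → (K : ℕ) → Blk K → List M → List Q × M
  elimEq k s (v ∷ B) K Bs D =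
    Data.Product.map₁ (s ∷_) (elimEq (suc k) s B K Bs (expand k v D))
  elimEq k s [] zero [] D = [] , joinFam s D
  elimEq k s [] (suc K) Bs D = openBlock k (flipQ s) (mergeFam s D Bs)

  -- A block of kind s is opened by a vacuous quantifier on c_k, so that
  -- no block of the output is empty.
  openBlock : ∀ {K} → ℕ → Q → Blk (suc K) × M → List Q × M
  openBlock {K} k s (Cs , μ) =
    Data.Product.map₁ (s ∷_) (elimEq (suc k) s (Vec.head Cs) K (Vec.tail Cs) (μ ∷ []))

Earlier : ℕ → Name → Set
Earlier k (outVar j) = j < k
Earlier k _          = ⊥

unitOf-scoped : ∀ s {P : Name → Set} → AllN P (unitOf s)
unitOf-scoped ∃Q = tt
unitOf-scoped ∀Q = tt

Scope-weaken : ∀ k ns u → Scope (Earlier k) ns u → Scope (Earlier (suc k)) ns u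
Scope-weaken k ns (bnd p)    m   = m
Scope-weaken k ns (outVar j) j<k = ≤-trans j<k (n≤1+n k)

Eliminable : ℕ → List Name → List M → Set
Eliminable k ns D = All IsBnd ns × Unique ns × All (AllN (Scope (Earlier k) ns)) D

mergeFam-scoped : ∀ {K} s D (Bs : Blk K) k → WellNamed Bs → All (AllN (Scope (Earlier k) (allNames Bs))) D →
                  Scoped (Earlier k) (mergeFam s D Bs)
mergeFam-scoped {K} s [] Bs k w sc = emptyBlk-wellNamed K , unitOf-scoped s
mergeFam-scoped s (μ ∷ D) Bs k w (s₁ ∷ sc) =
  combine-scoped (connOf s) (Bs , μ) (mergeFam s D Bs) (λ _ p → p) (λ _ p → p)
                 (w , s₁) (mergeFam-scoped s D Bs k w sc)

expand-eliminable : ∀ k v ns D → Eliminable k (v ∷ ns) D → Eliminable (suc k) ns (expand k v D)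
expand-eliminable k v ns D (_ ∷ bs , _ ∷ u , sc) =
  bs , u , Allₚ.concat⁺ (Allₚ.map⁺ (All.map (λ {μ} sμ → Allₚ.map⁺ (All.tabulate (λ {w} w∈ →
             AllN-ren-map (replace v w) (renamed w (outVars-< w∈)) μ sμ))) sc))
  where
  renamed : ∀ w → (Σ ℕ λ j → w ≡ outVar j × j < suc k) →
            ∀ u → Scope (Earlier k) (v ∷ ns) u → Scope (Earlier (suc k)) ns (replace v w u)
  renamed w (j , refl , j<) u h with u ≟N v
  ... | yes _ = j<
  renamed w _ (bnd p)    (here e)  | no ne = contradiction e ne
  renamed w _ (bnd p)    (there m) | no ne = m
  renamed w _ (outVar i) i<k       | no ne = Scope-weaken k ns (outVar i) i<k

changes : Q → List Q → ℕ
changes s [] = 0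
changes s (z ∷ zs) = diff s z + changes z zs

diff-same : ∀ s → diff s s ≡ 0
diff-same ∃Q = refl
diff-same ∀Q = refl

diff-flip : ∀ s → diff s (flipQ s) ≡ 1
diff-flip ∃Q = refl
diff-flip ∀Q = refl

elimEq-changes : ∀ K k s B (Bs : Blk K) D → changes s (proj₁ (elimEq k s B K Bs D)) ≡ K
elimEq-changes K k s (v ∷ B) Bs D =
  trans (cong (_+ changes s (proj₁ (elimEq (suc k) s B K Bs (expand k v D)))) (diff-same s))
        (elimEq-changes K (suc k) s B Bs (expand k v D))
elimEq-changes zero k s [] [] D = refl
elimEq-changes (suc K) k s [] Bs D =
  cong₂ _+_ (diff-flip s)
            (elimEq-changes K (suc k) (flipQ s) (Vec.head Cs) (Vec.tail Cs) (proj₂ (mergeFam s D Bs) ∷ []))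
  where Cs = proj₁ (mergeFam s D Bs)

openBlock-eliminable : ∀ {K} k (r : Blk (suc K) × M) → Scoped (Earlier k) r →
                       Eliminable (suc k) (Vec.head (proj₁ r) ++ allNames (Vec.tail (proj₁ r))) (proj₂ r ∷ [])
openBlock-eliminable k (C ∷ Cs , μ) ((bs , u) , sμ) = bs , u , AllN-map (Scope-weaken k _) μ sμ ∷ []

mutual
  elimEq-scope : ∀ K k s B (Bs : Blk K) D → Eliminable k (B ++ allNames Bs) D →
                 AllN (Scope (Earlier (k + length (proj₁ (elimEq k s B K Bs D)))) [])
                      (proj₂ (elimEq k s B K Bs D))
  elimEq-scope K k s (v ∷ B) Bs D inv =
    subst (λ t → AllN (Scope (Earlier t) []) (proj₂ (elimEq (suc k) s B K Bs (expand k v D))))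
          (sym (+-suc k _))
          (elimEq-scope K (suc k) s B Bs (expand k v D) (expand-eliminable k v _ D inv))
  elimEq-scope zero k s [] [] D (_ , _ , sc) =
    subst (λ t → AllN (Scope (Earlier t) []) (joinFam s D)) (sym (+-identityʳ k)) (join s D sc)
    where
    join : ∀ s D → All (AllN (Scope (Earlier k) [])) D → AllN (Scope (Earlier k) []) (joinFam s D)
    join s [] [] = unitOf-scoped s
    join s (μ ∷ D) (sμ ∷ sc) = sμ , join s D sc
  elimEq-scope (suc K) k s [] Bs D (bs , u , sc) =
    openBlock-scope k (flipQ s) (mergeFam s D Bs) (mergeFam-scoped s D Bs k (bs , u) sc)

  openBlock-scope : ∀ {K} k s (r : Blk (suc K) × M) → Scoped (Earlier k) r →
                    AllN (Scope (Earlier (k + length (proj₁ (openBlock k s r)))) []) (proj₂ (openBlock k s r))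
  openBlock-scope {K} k s r sc =
    subst (λ t → AllN (Scope (Earlier t) []) (proj₂ (openBlock k s r))) (sym (+-suc k _))
          (elimEq-scope K (suc k) s (Vec.head (proj₁ r)) (Vec.tail (proj₁ r)) (proj₂ r ∷ [])
                        (openBlock-eliminable k r sc))

module _ {n : ℕ} where
  open import Data.List.Membership.DecPropositional (_≟F_ {n}) using (_∈?_)

  freshVertex : (xs : List (Fin n)) → length xs < n → Σ (Fin n) λ a → a ∉ xs
  freshVertex xs lt with Finₚ.any? (λ a → ¬? (a ∈? xs))
  ... | yes found = found
  ... | no ¬found = contradiction (Finₚ.pigeonhole lt (λ a → Any.index (member a))) noCollision
    where
    member : ∀ a → a ∈ xs
    member a = decidable-stable (a ∈? xs) (λ a∉ → ¬found (a , a∉))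
    noCollision : ¬ Σ (Fin n) λ i → Σ (Fin n) λ j →
                      Data.Fin._<_ i j × Any.index (member i) ≡ Any.index (member j)
    noCollision (i , j , i<j , e) =
      Finₚ.<-irrefl (SetoidMembershipₚ.index-injective (≡-setoid (Fin n)) (member i) (member j) e) i<j

  avoid-exists : ∀ {A : Set} (f : A → Fin n) (xs : List A) → length xs < n →
                 Σ (Fin n) λ a → All (λ x → a ≢ f x) xs
  avoid-exists f xs lt with freshVertex (map f xs) (subst (_< n) (sym (Listₚ.length-map f xs)) lt)
  ... | a , a∉ = a , Allₚ.map⁻ (Allₚ.¬Any⇒All¬ _ a∉)

Fam : ∀ {A : Set} → Q → (A → Set) → List A → Set
Fam ∃Q P D = Any P D
Fam ∀Q P D = All P D

Fam-⇔ : ∀ {A : Set} s {P R : A → Set} {D} → All (λ x → P x ⇔ R x) D → Fam s P D ⇔ Fam s R D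
Fam-⇔ ∃Q [] = mk⇔ (λ ()) (λ ())
Fam-⇔ ∃Q (h ∷ hs) =
  mk⇔ (λ { (here p) → here (to h p) ; (there q) → there (to (Fam-⇔ ∃Q hs) q) })
      (λ { (here p) → here (from h p) ; (there q) → there (from (Fam-⇔ ∃Q hs) q) })
Fam-⇔ ∀Q [] = mk⇔ (λ _ → []) (λ _ → [])
Fam-⇔ ∀Q (h ∷ hs) =
  mk⇔ (λ { (p ∷ ps) → to h p ∷ to (Fam-⇔ ∀Q hs) ps })
      (λ { (p ∷ ps) → from h p ∷ from (Fam-⇔ ∀Q hs) ps })

Fam-cons : ∀ {A : Set} s {P : A → Set} {x D} → Fam s P (x ∷ D) ⇔ (P x ⊙⟨ connOf s ⟩ Fam s P D)
Fam-cons ∃Q = mk⇔ (λ { (here p) → inj₁ p ; (there q) → inj₂ q }) [ here , there ]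
Fam-cons ∀Q = mk⇔ (λ { (p ∷ ps) → p , ps }) (λ (p , ps) → p ∷ ps)

Fam-single : ∀ {A : Set} s {P : A → Set} {x} → Fam s P (x ∷ []) ⇔ P x
Fam-single ∃Q = mk⇔ (λ { (here p) → p ; (there ()) }) here
Fam-single ∀Q = mk⇔ All.head (_∷ [])

Fam-concatMap : ∀ {A B C : Set} s {P : C → Set} (g : A → B → C) (xs : List A) (ys : List B) →
  Fam s P (Data.List.concatMap (λ x → map (g x) ys) xs) ⇔ Fam s (λ x → Fam s (λ y → P (g x y)) ys) xs
Fam-concatMap ∃Q g xs ys =
  mk⇔ (λ p → Any.map Anyₚ.map⁻ (Anyₚ.map⁻ (Anyₚ.concat⁻ _ p)))
      (λ p → Anyₚ.concat⁺ (Anyₚ.map⁺ (Any.map Anyₚ.map⁺ p)))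
Fam-concatMap ∀Q g xs ys =
  mk⇔ (λ p → All.map Allₚ.map⁻ (Allₚ.map⁻ (Allₚ.concat⁻ p)))
      (λ p → Allₚ.concat⁺ (Allₚ.map⁺ (All.map Allₚ.map⁺ p)))

module ElimSem {n : ℕ} (G : Graph n) where
  open Sem G
  open CombineSem G

  Fresh : Env → ℕ → Fin n → Set
  Fresh ρ k a = All (λ w → a ≢ ρ w) (outVars k)

  DSat : Env → ℕ → List Q → M → Set
  DSat ρ k [] μ = ⟦ μ ⟧ ρ
  DSat ρ k (z ∷ zs) μ = QuantOn z (Fresh ρ k) (λ a → DSat (upd ρ (outVar k) a) (suc k) zs μ)

  fresh-exists : ∀ ρ k → k < n → Σ (Fin n) (Fresh ρ k)
  fresh-exists ρ k k<n = avoid-exists ρ (outVars k) (subst (_< n) (sym (outVars-length k)) k<n)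

  Fam-swap : ∀ s ρ k (X : M → Fin n → Set) D →
             Fam s (λ μ → QuantOn s (Fresh ρ k) (X μ)) D ⇔
             QuantOn s (Fresh ρ k) (λ a → Fam s (λ μ → X μ a) D)
  Fam-swap ∃Q ρ k X D = mk⇔ pull (λ (a , f , p) → Any.map (λ x → a , f , x) p)
    where
    pull : ∀ {D} → Any (λ μ → QuantOn ∃Q (Fresh ρ k) (X μ)) D →
           QuantOn ∃Q (Fresh ρ k) (λ a → Any (λ μ → X μ a) D)
    pull (here (a , f , x)) = a , f , here x
    pull (there p) = let (a , f , q) = pull p in a , f , there q
  Fam-swap ∀Q ρ k X D =
    mk⇔ (λ g a f → All.map (λ h → h a f) g) (λ h → All.tabulate (λ m a f → All.lookup (h a f) m))

  -- Once c_k holds a vertex distinct from c_0 … c_{k-1}, every vertex is the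
  -- value of one of c_0 … c_k.
  choose : ∀ ρ k → k < n → ∀ a → Σ (Fin n) λ a' → Fresh ρ k a' ×
           Σ Name λ w → w ∈ outVars (suc k) × upd ρ (outVar k) a' w ≡ a
  choose ρ k k<n a with Any.any? (λ w → a ≟F ρ w) (outVars k)
  ... | yes old = let (w , w∈ , e) = find old ; (a' , f) = fresh-exists ρ k k<n in
                  a' , f , w , there w∈ , trans (upd-miss ρ (outVar k) a' w (outVar≢ w∈)) (sym e)
    where
    outVar≢ : ∀ {w} → w ∈ outVars k → w ≢ outVar k
    outVar≢ w∈ refl with outVars-< w∈
    ... | j , refl , j<k = <-irrefl refl j<k
  ... | no new  = a , Allₚ.¬Any⇒All¬ _ new , outVar k , here refl , upd-hit ρ (outVar k) a

  decompose : ∀ s ρ k (P : Fin n → Set) → k < n →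
    Quant s P ⇔ QuantOn s (Fresh ρ k) (λ a → Fam s (λ w → P (upd ρ (outVar k) a w)) (outVars (suc k)))
  decompose ∃Q ρ k P k<n = mk⇔
    (λ (a , p) → let (a' , f , w , w∈ , e) = choose ρ k k<n a in a' , f , lose w∈ (subst P (sym e) p))
    (λ (a' , f , p) → let (w , q) = Any.satisfied p in upd ρ (outVar k) a' w , q)
  decompose ∀Q ρ k P k<n = mk⇔
    (λ g a' f → All.tabulate (λ {w} _ → g (upd ρ (outVar k) a' w)))
    (λ h a → let (a' , f , w , w∈ , e) = choose ρ k k<n a in subst P e (All.lookup (h a' f) w∈))

  replace-sem : ∀ ρ k v L μ a j → v ∉ nm L → All IsBnd (nm L) → AllN (Scope (Earlier k) (v ∷ nm L)) μ →
    PSat (upd ρ (outVar k) a) L (ren (replace v (outVar j)) μ) ⇔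
    PSat (upd ρ v (upd ρ (outVar k) a (outVar j))) L μ
  replace-sem ρ k v L μ a j v∉ bs sc =
    subst (λ L' → PSat ρ' L' (ren (replace v (outVar j)) μ) ⇔ PSat (upd ρ v (ρ' (outVar j))) L μ) fixes
      (⇔.trans (PSat-ren (replace v (outVar j)) L μ ρ' injective) (PSat-coin L μ _ _ (AllN-map agree μ sc)))
    where
    ρ' = upd ρ (outVar k) a
    fixes : mapN (replace v (outVar j)) L ≡ L
    fixes = Listₚ.map-id-local (All.tabulate (λ {(z , u)} m → cong (z ,_) (fix u (∈-map⁺ proj₂ m))))
      where
      fix : ∀ u → u ∈ nm L → replace v (outVar j) u ≡ u
      fix u u∈ with u ≟N v
      ... | yes refl = contradiction u∈ v∉
      ... | no _     = refl
    outVar≢bnd : ∀ x → IsBnd x → outVar j ≢ x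
    outVar≢bnd (bnd p) _ ()
    injective : ∀ x → x ∈ nm L → ∀ u → replace v (outVar j) u ≡ replace v (outVar j) x → u ≡ x
    injective x x∈ u e with x ≟N v | u ≟N v
    ... | yes refl | _     = contradiction x∈ v∉
    ... | no _     | no _  = e
    ... | no _     | yes _ = ⊥-elim (outVar≢bnd x (All.lookup bs x∈) e)
    agree : ∀ u → Scope (Earlier k) (v ∷ nm L) u →
            u ∈ nm L ⊎ ρ' (replace v (outVar j) u) ≡ upd ρ v (ρ' (outVar j)) u
    agree u h with u ≟N v
    ... | yes refl = inj₂ refl
    agree (bnd p)    (here e)  | no ne = contradiction e ne
    agree (bnd p)    (there m) | no ne = inj₁ m
    agree (outVar i) i<k       | no ne =
      inj₂ (upd-miss ρ (outVar k) a (outVar i) (λ { refl → <-irrefl refl i<k }))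

  expand-sem : ∀ s ρ k v L D → k < n → v ∉ nm L → All IsBnd (nm L) →
    All (AllN (Scope (Earlier k) (v ∷ nm L))) D →
    Fam s (PSat ρ ((s , v) ∷ L)) D ⇔
    QuantOn s (Fresh ρ k) (λ a → Fam s (PSat (upd ρ (outVar k) a) L) (expand k v D))
  expand-sem s ρ k v L D k<n v∉ bs sc =
    ⇔.trans (Fam-⇔ s (All.map (λ _ → decompose s ρ k _ k<n) sc))
   (⇔.trans (Fam-swap s ρ k _ D)
            (QuantOn-body-⇔ s (λ a →
               ⇔.trans (Fam-⇔ s (All.map (substituted a) sc))
                       (⇔.sym (Fam-concatMap s (λ μ w → ren (replace v w) μ) D (outVars (suc k)))))))
    where
    substituted : ∀ a {μ} → AllN (Scope (Earlier k) (v ∷ nm L)) μ →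
      Fam s (λ w → PSat (upd ρ v (upd ρ (outVar k) a w)) L μ) (outVars (suc k)) ⇔
      Fam s (λ w → PSat (upd ρ (outVar k) a) L (ren (replace v w) μ)) (outVars (suc k))
    substituted a {μ} sμ = Fam-⇔ s (All.tabulate (λ w∈ → replaced (outVars-< w∈)))
      where
      replaced : ∀ {w} → (Σ ℕ λ j → w ≡ outVar j × j < suc k) →
           PSat (upd ρ v (upd ρ (outVar k) a w)) L μ ⇔ PSat (upd ρ (outVar k) a) L (ren (replace v w) μ)
      replaced (j , refl , _) = ⇔.sym (replace-sem ρ k v L μ a j v∉ bs sμ)

  tag-coin : ∀ i k L μ ρ → AllN (Scope (Earlier k) (nm L)) μ →
             PSat (λ u → ρ (tag i u)) L μ ⇔ PSat ρ L μ
  tag-coin i k L μ ρ sc = PSat-coin L μ _ _ (AllN-map agree μ sc)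
    where
    agree : ∀ u → Scope (Earlier k) (nm L) u → u ∈ nm L ⊎ ρ (tag i u) ≡ ρ u
    agree (bnd p)    m = inj₁ m
    agree (outVar j) _ = inj₂ refl

  join-sem : ∀ s ρ D → Fam s (λ μ → ⟦ μ ⟧ ρ) D ⇔ ⟦ joinFam s D ⟧ ρ
  join-sem ∃Q ρ [] = mk⇔ (λ ()) (λ ())
  join-sem ∀Q ρ [] = mk⇔ (λ _ → tt) (λ _ → [])
  join-sem s ρ (μ ∷ D) = ⇔.trans (Fam-cons s) (⊙-⇔ (connOf s) ⇔.refl (join-sem s ρ D))

  mergeFam-sem : ∀ {K} s s' D (Bs : Blk K) ρ k → WellNamed Bs →
    All (AllN (Scope (Earlier k) (allNames Bs))) D →
    PSat ρ (flat s' (proj₁ (mergeFam s D Bs))) (proj₂ (mergeFam s D Bs)) ⇔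
    Fam s (PSat ρ (flat s' Bs)) D
  mergeFam-sem {K} s s' [] Bs ρ k w sc rewrite flat-empty K s' = ⇔.trans (unit s) (⇔.sym (Fam-empty s))
    where
    unit : ∀ s → ⟦ unitOf s ⟧ ρ ⇔ Fam s (λ μ → ⟦ μ ⟧ ρ) []
    unit s = ⇔.sym (join-sem s ρ [])
    Fam-empty : ∀ s → Fam s (PSat ρ (flat s' Bs)) [] ⇔ Fam s (λ μ → ⟦ μ ⟧ ρ) []
    Fam-empty ∃Q = mk⇔ (λ ()) (λ ())
    Fam-empty ∀Q = mk⇔ (λ _ → []) (λ _ → [])
  mergeFam-sem s s' (μ ∷ D) Bs ρ k w@(bs , _) (sμ ∷ sc) =
    ⇔.trans (combine-sem (connOf s) s' Bs Cs μ ν ρ bs (proj₁ (proj₁ (mergeFam-scoped s D Bs k w sc))))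
   (⇔.trans (⊙-⇔ (connOf s) (tag-coin 1 k (flat s' Bs) μ ρ (inFlat sμ))
                             (⇔.trans (mergeFam-sem s s' D Bs (λ u → ρ (tag 2 u)) k w sc)
                                      (Fam-⇔ s (All.map (λ sμ' → tag-coin 2 k (flat s' Bs) _ ρ (inFlat sμ'))
                                                        sc))))
            (⇔.sym (Fam-cons s)))
    where
    Cs = proj₁ (mergeFam s D Bs)
    ν  = proj₂ (mergeFam s D Bs)
    inFlat : ∀ {μ} → AllN (Scope (Earlier k) (allNames Bs)) μ →
             AllN (Scope (Earlier k) (nm (flat s' Bs))) μ
    inFlat {μ} = subst (λ ns → AllN (Scope (Earlier k) ns) μ) (sym (nm-flat s' Bs))

  vacuous-sem : ∀ s ρ k L D → k < n → All (AllN (Scope (Earlier k) (nm L))) D →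
    Fam s (PSat ρ L) D ⇔ QuantOn s (Fresh ρ k) (λ a → Fam s (PSat (upd ρ (outVar k) a) L) D)
  vacuous-sem s ρ k L D k<n sc =
    ⇔.trans (⇔.sym (QuantOn-const s (fresh-exists ρ k k<n)))
            (QuantOn-body-⇔ s (λ a →
               Fam-⇔ s (All.map (λ {μ} sμ → PSat-coin L μ _ _ (AllN-map (agree a) μ sμ)) sc)))
    where
    agree : ∀ a u → Scope (Earlier k) (nm L) u → u ∈ nm L ⊎ ρ u ≡ upd ρ (outVar k) a u
    agree a (bnd p)    m   = inj₁ m
    agree a (outVar j) j<k = inj₂ (sym (upd-miss ρ (outVar k) a (outVar j) (λ { refl → <-irrefl refl j<k })))

  single-head : ∀ {K} s (Cs : Blk (suc K)) μ ρ →
    PSat ρ (flat s Cs) μ ⇔ Fam s (PSat ρ (map (s ,_) (Vec.head Cs) ++ flat (flipQ s) (Vec.tail Cs))) (μ ∷ [])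
  single-head s (C ∷ Cs) μ ρ = ⇔.sym (Fam-single s)

  mutual
    elimEq-sem : ∀ K k s B (Bs : Blk K) D → Eliminable k (B ++ allNames Bs) D → ∀ ρ →
      k + length (proj₁ (elimEq k s B K Bs D)) < n →
      Fam s (PSat ρ (map (s ,_) B ++ flat (flipQ s) Bs)) D ⇔
      DSat ρ k (proj₁ (elimEq k s B K Bs D)) (proj₂ (elimEq k s B K Bs D))
    elimEq-sem K k s (v ∷ B) Bs D inv@(_ ∷ bs , v∉ ∷ _ , sc) ρ lt =
      ⇔.trans (expand-sem s ρ k v L D (m+n≤o⇒m≤o (suc k) (<⇒≤ lt'))
                          (subst (v ∉_) (sym nmL) (Allₚ.All¬⇒¬Any v∉)) (subst (All IsBnd) (sym nmL) bs)
                          (subst (λ ns → All (AllN (Scope (Earlier k) (v ∷ ns))) D) (sym nmL) sc))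
              (QuantOn-body-⇔ s (λ a →
                 elimEq-sem K (suc k) s B Bs (expand k v D) (expand-eliminable k v _ D inv)
                            (upd ρ (outVar k) a) lt'))
      where
      L = map (s ,_) B ++ flat (flipQ s) Bs
      nmL = nm-blocks s B Bs
      lt' = subst (_< n) (+-suc k _) lt
    elimEq-sem zero k s [] [] D inv ρ lt = join-sem s ρ D
    elimEq-sem (suc K) k s [] Bs D (bs , u , sc) ρ lt =
      ⇔.trans (⇔.sym (mergeFam-sem s (flipQ s) D Bs ρ k (bs , u) sc))
              (openBlock-sem k (flipQ s) (mergeFam s D Bs) (mergeFam-scoped s D Bs k (bs , u) sc) ρ lt)

    openBlock-sem : ∀ {K} k s (r : Blk (suc K) × M) → Scoped (Earlier k) r → ∀ ρ →
      k + length (proj₁ (openBlock k s r)) < n →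
      PSat ρ (flat s (proj₁ r)) (proj₂ r) ⇔ DSat ρ k (proj₁ (openBlock k s r)) (proj₂ (openBlock k s r))
    openBlock-sem {K} k s r@(C ∷ Cs , μ) sc ρ lt =
      ⇔.trans (single-head s (C ∷ Cs) μ ρ)
     (⇔.trans (vacuous-sem s ρ k L (μ ∷ []) (m+n≤o⇒m≤o (suc k) (<⇒≤ lt'))
                           (subst (λ ns → AllN (Scope (Earlier k) ns) μ) (sym (nm-blocks s C Cs)) (proj₂ sc)
                             ∷ []))
              (QuantOn-body-⇔ s (λ a →
                 elimEq-sem K (suc k) s C Cs (μ ∷ []) (openBlock-eliminable k r sc) (upd ρ (outVar k) a) lt')))
      where
      L = map (s ,_) C ++ flat (flipQ s) Cs
      lt' = subst (_< n) (+-suc k _) lt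

-- The output variable c_j is rendered as the variable j.
var : Name → ℕ
var (outVar j) = j
var _          = 0

-- Truth values without equality: graphs have no loops.
⊤F ⊥F : Form
⊤F = 0 ≁ 0
⊥F = 0 ∼ 0

decF : ∀ {A : Set} → Dec A → Form
decF (yes _) = ⊤F
decF (no _)  = ⊥F

-- Distinct output variables will denote distinct vertices, so equality
-- atoms between them are decided syntactically.
toQF : M → Form
toQF mT = ⊤F
toQF mF = ⊥F
toQF (eE a b) = var a ∼ var b
toQF (eN a b) = var a ≁ var b
toQF (eEq a b) = decF (a ≟N b)
toQF (eNe a b) = decF (¬? (a ≟N b))
toQF (bin conj μ ν) = toQF μ ∧ toQF ν
toQF (bin disj μ ν) = toQF μ ∨ toQF ν

decF-qf : ∀ {A : Set} (d : Dec A) → QFNoEq (decF d)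
decF-qf (yes _) = q≁
decF-qf (no _)  = q∼

toQF-qf : ∀ μ → QFNoEq (toQF μ)
toQF-qf mT = q≁
toQF-qf mF = q∼
toQF-qf (eE a b) = q∼
toQF-qf (eN a b) = q≁
toQF-qf (eEq a b) = decF-qf (a ≟N b)
toQF-qf (eNe a b) = decF-qf (¬? (a ≟N b))
toQF-qf (bin conj μ ν) = q∧ (toQF-qf μ) (toQF-qf ν)
toQF-qf (bin disj μ ν) = q∨ (toQF-qf μ) (toQF-qf ν)

num : ℕ → List Q → List (Q × ℕ)
num k [] = []
num k (z ∷ zs) = (z , k) ∷ num (suc k) zs

-- The state of the guards of an NEPNF matrix: a violated guard forces the
-- matrix to false (∃) or true (∀), the most recently bound variable first.
data Status : Set where
  undecided forcedFalse forcedTrue : Status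

violated : Q → Status
violated ∃Q = forcedFalse
violated ∀Q = forcedTrue

check : Bool → Status → Q → Status
check true  s z = s
check false s z = violated z

under : Status → Set → Set
under undecided   X = X
under forcedFalse X = ⊥
under forcedTrue  X = ⊤

checked : ∀ z s₀ X {F : Set} (d : Dec F) → under (check (does d) s₀ z) X ⇔ Guarded z F (under s₀ X)
checked ∃Q s₀ X (yes f) = mk⇔ (f ,_) proj₂
checked ∃Q s₀ X (no ¬f) = mk⇔ (λ ()) (λ (f , _) → contradiction f ¬f)
checked ∀Q s₀ X (yes f) = mk⇔ (λ x _ → x) (λ g → g f)
checked ∀Q s₀ X (no ¬f) = mk⇔ (λ _ f → contradiction f ¬f) (λ _ → tt)

module Render {n : ℕ} (G : Graph n) where
  open Sem G
  open PrenexSem G using (Sat-quant)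
  open ElimSem G using (Fresh; DSat)

  Avoids : (ℕ → Fin n) → List ℕ → Fin n → Set
  Avoids ρ ys a = All (λ y → a ≢ ρ y) ys

  avoid? : ∀ ρ ys a → Dec (Avoids ρ ys a)
  avoid? ρ ys a = All.all? (λ y → ¬? (a ≟F ρ y)) ys

  FSat : Form → (ℕ → Fin n) → ℕ → List Q → Set
  FSat φ₁ ρ k [] = Sat G ρ φ₁
  FSat φ₁ ρ k (z ∷ zs) = QuantOn z (Avoids ρ (downFrom k)) (λ a → FSat φ₁ (ρ [ k ↦ a ]) (suc k) zs)

  guard-sem : ∀ z ρ x ys ψ → Sat G ρ (guard z x ys ψ) ⇔ Guarded z (Avoids ρ ys (ρ x)) (Sat G ρ ψ)
  guard-sem ∃Q ρ x [] ψ = mk⇔ ([] ,_) proj₂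
  guard-sem ∀Q ρ x [] ψ = mk⇔ (λ s _ → s) (λ g → g [])
  guard-sem ∃Q ρ x (y ∷ ys) ψ =
    ⇔.trans (⇔.refl ×-⇔ guard-sem ∃Q ρ x ys ψ)
            (mk⇔ (λ (ne , a , s) → ne ∷ a , s) (λ { (ne ∷ a , s) → ne , a , s }))
  guard-sem ∀Q ρ x (y ∷ ys) ψ =
    ⇔.trans (⇔.refl ⊎-⇔ guard-sem ∀Q ρ x ys ψ)
            (mk⇔ [ (λ { e (ne ∷ _) → contradiction e ne }) , (λ { g (_ ∷ a) → g a }) ] split)
    where
    split : (Avoids ρ (y ∷ ys) (ρ x) → Sat G ρ ψ) → (ρ x ≡ ρ y) ⊎ (Avoids ρ ys (ρ x) → Sat G ρ ψ)
    split h with ρ x ≟F ρ y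
    ... | yes e = inj₁ e
    ... | no ne = inj₂ (λ a → h (ne ∷ a))

  status : (ℕ → Fin n) → List (Q × ℕ) → Status
  status ρ [] = undecided
  status ρ ((z , x) ∷ P) = check (does (avoid? ρ (map proj₂ P) (ρ x))) (status ρ P) z

  matrix-sem : ∀ φ₁ ρ P → Sat G ρ (matrix P φ₁) ⇔ under (status ρ P) (Sat G ρ φ₁)
  matrix-sem φ₁ ρ [] = ⇔.refl
  matrix-sem φ₁ ρ (_ ∷ []) = ⇔.refl
  matrix-sem φ₁ ρ ((z , x) ∷ R@(_ ∷ _)) =
    ⇔.trans (guard-sem z ρ x (map proj₂ R) (matrix R φ₁))
   (⇔.trans (Guarded-⇔ z ⇔.refl (λ _ → matrix-sem φ₁ ρ R))
            (⇔.sym (checked z (status ρ R) _ (avoid? ρ (map proj₂ R) (ρ x)))))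

  Avoids-cong : ∀ {ρ ρ' ys a a'} → a ≡ a' → (∀ {y} → y ∈ ys → ρ y ≡ ρ' y) →
                Avoids ρ ys a ⇔ Avoids ρ' ys a'
  Avoids-cong refl h = mk⇔ (λ av → All.tabulate (λ m e → All.lookup av m (trans e (sym (h m)))))
                           (λ av → All.tabulate (λ m e → All.lookup av m (trans e (h m))))

  status-cong : ∀ ρ ρ' P → (∀ {y} → y ∈ map proj₂ P → ρ y ≡ ρ' y) → status ρ P ≡ status ρ' P
  status-cong ρ ρ' [] h = refl
  status-cong ρ ρ' ((z , x) ∷ P) h =
    cong₂ (λ b s → check b s z)
          (does-⇔ (Avoids-cong (h (here refl)) (λ m → h (there m))) (avoid? ρ _ (ρ x)) (avoid? ρ' _ (ρ' x)))
          (status-cong ρ ρ' P (λ m → h (there m)))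

  upd-hitℕ : ∀ (ρ : ℕ → Fin n) k a → (ρ [ k ↦ a ]) k ≡ a
  upd-hitℕ ρ k a with k ≟ k
  ... | yes _ = refl
  ... | no ne = contradiction refl ne

  upd-missℕ : ∀ (ρ : ℕ → Fin n) k a y → y ≢ k → (ρ [ k ↦ a ]) y ≡ ρ y
  upd-missℕ ρ k a y ne with y ≟ k
  ... | yes e = contradiction e ne
  ... | no _  = refl

  status-step : ∀ ρ z k P a → map proj₂ P ≡ downFrom k →
    status (ρ [ k ↦ a ]) ((z , k) ∷ P) ≡ check (does (avoid? ρ (downFrom k) a)) (status ρ P) z
  status-step ρ z k P a eq =
    cong₂ (λ b s → check b s z) (does-⇔ fresh (avoid? ρ' _ (ρ' k)) (avoid? ρ _ a))
          (status-cong ρ' ρ P (λ {y} m → upd-missℕ ρ k a y (earlier m)))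
    where
    ρ' = ρ [ k ↦ a ]
    earlier : ∀ {y} → y ∈ map proj₂ P → y ≢ k
    earlier {y} m refl = <-irrefl refl (∈-downFrom⁻ (subst (y ∈_) eq m))
    fresh : Avoids ρ' (map proj₂ P) (ρ' k) ⇔ Avoids ρ (downFrom k) a
    fresh = subst (λ ys → Avoids ρ' (map proj₂ P) (ρ' k) ⇔ Avoids ρ ys a) eq
                  (Avoids-cong (upd-hitℕ ρ k a) (λ {y} m → upd-missℕ ρ k a y (earlier m)))

  under-QuantOn : ∀ z s₀ {F X : Fin n → Set} → Σ (Fin n) F →
                  QuantOn z F (λ a → under s₀ (X a)) ⇔ under s₀ (QuantOn z F X)
  under-QuantOn z undecided   w = ⇔.refl
  under-QuantOn z forcedFalse w = QuantOn-const z w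
  under-QuantOn z forcedTrue  w = QuantOn-const z w

  revcons : ∀ {A : Set} (a : A) L P → reverse (a ∷ L) ++ P ≡ reverse L ++ (a ∷ P)
  revcons a L P = trans (cong (_++ P) (Listₚ.unfold-reverse a L)) (Listₚ.++-assoc (reverse L) (a ∷ []) P)

  nepnf-sem : ∀ φ₁ zs k P ρ → map proj₂ P ≡ downFrom k → k + length zs < n →
    Sat G ρ (prefix (num k zs) (matrix (reverse (num k zs) ++ P) φ₁)) ⇔ under (status ρ P) (FSat φ₁ ρ k zs)
  nepnf-sem φ₁ [] k P ρ eq lt = matrix-sem φ₁ ρ P
  nepnf-sem φ₁ (z ∷ zs) k P ρ eq lt
    rewrite revcons (z , k) (num (suc k) zs) P =
    ⇔.trans (Sat-quant z k _ ρ)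
   (⇔.trans (Quant-⇔ z (λ a →
               ⇔.trans (nepnf-sem φ₁ zs (suc k) ((z , k) ∷ P) (ρ [ k ↦ a ]) (cong (k ∷_) eq) lt')
              (⇔.trans (subst (λ s → under (status (ρ [ k ↦ a ]) ((z , k) ∷ P)) _ ⇔ under s _)
                              (status-step ρ z k P a eq) ⇔.refl)
                       (checked z (status ρ P) _ (avoid? ρ (downFrom k) a)))))
            (under-QuantOn z (status ρ P) witness))
    where
    lt' = subst (_< n) (+-suc k _) lt
    witness : Σ (Fin n) (Avoids ρ (downFrom k))
    witness = avoid-exists ρ (downFrom k)
                           (subst (_< n) (sym (Listₚ.length-downFrom k)) (m+n≤o⇒m≤o (suc k) (<⇒≤ lt')))

  Distinct : (ℕ → Fin n) → ℕ → Set
  Distinct ρ m = ∀ {i j} → i < m → j < m → ρ i ≡ ρ j → i ≡ j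

  below : ∀ {i k} → i < suc k → i ≢ k → i < k
  below i< i≢k = ≤∧≢⇒< (≤-pred i<) i≢k

  distinct-extend : ∀ ρ k a → Distinct ρ k → Avoids ρ (downFrom k) a → Distinct (ρ [ k ↦ a ]) (suc k)
  distinct-extend ρ k a d fr {i} {j} i< j< e with i ≟ k | j ≟ k
  ... | yes refl | yes refl = refl
  ... | yes refl | no j≢k   = contradiction e (All.lookup fr (∈-downFrom⁺ (below j< j≢k)))
  ... | no i≢k   | yes refl = contradiction (sym e) (All.lookup fr (∈-downFrom⁺ (below i< i≢k)))
  ... | no i≢k   | no j≢k   = d (below i< i≢k) (below j< j≢k) e

  Represents : (ℕ → Fin n) → Env → Set
  Represents ρ τ = ∀ j → τ (outVar j) ≡ ρ j

  represents-upd : ∀ ρ τ k a → Represents ρ τ → Represents (ρ [ k ↦ a ]) (upd τ (outVar k) a)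
  represents-upd ρ τ k a r j = cases (j ≟ k)
    where
    cases : Dec (j ≡ k) → upd τ (outVar k) a (outVar j) ≡ (ρ [ k ↦ a ]) j
    cases (yes refl) = trans (upd-hit τ (outVar j) a) (sym (upd-hitℕ ρ j a))
    cases (no j≢k)   = trans (upd-miss τ (outVar k) a (outVar j) (λ { refl → j≢k refl }))
                             (trans (r j) (sym (upd-missℕ ρ k a j j≢k)))

  -- Constant formulas, valid because no vertex has a loop.
  decF-sem : ∀ ρ {A : Set} (d : Dec A) → Sat G ρ (decF d) ⇔ A
  decF-sem ρ (yes a) = mk⇔ (λ _ → a) (λ _ → irrefl G (ρ 0))
  decF-sem ρ (no ¬a) = mk⇔ (λ loop → contradiction (trans (sym loop) (irrefl G (ρ 0))) (λ ()))
                           (λ a → contradiction a ¬a)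

  same-value : ∀ {m ρ τ i j} → Represents ρ τ → Distinct ρ m → i < m → j < m →
               (τ (outVar i) ≡ τ (outVar j)) ⇔ _≡_ {A = Name} (outVar i) (outVar j)
  same-value {i = i} {j} r d i< j< =
    mk⇔ (λ e → cong (λ j → outVar j) (d i< j< (trans (sym (r i)) (trans e (r j))))) (λ { refl → refl })

  toQF-sem : ∀ μ m ρ τ → Represents ρ τ → Distinct ρ m → AllN (Scope (Earlier m) []) μ →
             ⟦ μ ⟧ τ ⇔ Sat G ρ (toQF μ)
  toQF-sem mT m ρ τ r d sc = ⇔.sym (decF-sem ρ (yes tt))
  toQF-sem mF m ρ τ r d sc = ⇔.sym (decF-sem ρ (no (λ ())))
  toQF-sem (eE (outVar i) (outVar j)) m ρ τ r d sc rewrite r i | r j = ⇔.refl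
  toQF-sem (eN (outVar i) (outVar j)) m ρ τ r d sc rewrite r i | r j = ⇔.refl
  toQF-sem (eEq (outVar i) (outVar j)) m ρ τ r d (i< , j<) =
    ⇔.trans (same-value {τ = τ} r d i< j<) (⇔.sym (decF-sem ρ (outVar i ≟N outVar j)))
  toQF-sem (eNe (outVar i) (outVar j)) m ρ τ r d (i< , j<) =
    ⇔.trans (¬-cong-⇔ (same-value {τ = τ} r d i< j<)) (⇔.sym (decF-sem ρ (¬? (outVar i ≟N outVar j))))
  toQF-sem (bin conj μ ν) m ρ τ r d (sμ , sν) = toQF-sem μ m ρ τ r d sμ ×-⇔ toQF-sem ν m ρ τ r d sν
  toQF-sem (bin disj μ ν) m ρ τ r d (sμ , sν) = toQF-sem μ m ρ τ r d sμ ⊎-⇔ toQF-sem ν m ρ τ r d sν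

  bridge : ∀ μ zs k ρ τ → Represents ρ τ → Distinct ρ k → AllN (Scope (Earlier (k + length zs)) []) μ →
           DSat τ k zs μ ⇔ FSat (toQF μ) ρ k zs
  bridge μ [] k ρ τ r d sc =
    toQF-sem μ k ρ τ r d (subst (λ t → AllN (Scope (Earlier t) []) μ) (+-identityʳ k) sc)
  bridge μ (z ∷ zs) k ρ τ r d sc =
    QuantOn-⇔ z fresh (λ a f → bridge μ zs (suc k) (ρ [ k ↦ a ]) (upd τ (outVar k) a)
                                      (represents-upd ρ τ k a r) (distinct-extend ρ k a d (to (fresh a) f))
                                      (subst (λ t → AllN (Scope (Earlier t) []) μ) (+-suc k _) sc))
    where
    fresh : ∀ a → Fresh τ k a ⇔ Avoids ρ (downFrom k) a
    fresh a = mk⇔ (λ f → All.map (λ {j} ne e → ne (trans e (sym (r j)))) (Allₚ.map⁻ f))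
                  (λ f → Allₚ.map⁺ (All.map (λ {j} ne e → ne (trans e (r j))) f))

free-guard : ∀ z x ys ψ y → FreeIn y (guard z x ys ψ) → y ≡ x ⊎ y ∈ ys ⊎ FreeIn y ψ
free-guard ∃Q x [] ψ y fi = inj₂ (inj₂ fi)
free-guard ∀Q x [] ψ y fi = inj₂ (inj₂ fi)
free-guard ∃Q x (y' ∷ ys) ψ .x (f∧ˡ f≠ˡ) = inj₁ refl
free-guard ∃Q x (y' ∷ ys) ψ .y' (f∧ˡ f≠ʳ) = inj₂ (inj₁ (here refl))
free-guard ∃Q x (y' ∷ ys) ψ y (f∧ʳ fi) = Data.Sum.map₂ (Data.Sum.map₁ there) (free-guard ∃Q x ys ψ y fi)
free-guard ∀Q x (y' ∷ ys) ψ .x (f∨ˡ f=ˡ) = inj₁ refl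
free-guard ∀Q x (y' ∷ ys) ψ .y' (f∨ˡ f=ʳ) = inj₂ (inj₁ (here refl))
free-guard ∀Q x (y' ∷ ys) ψ y (f∨ʳ fi) = Data.Sum.map₂ (Data.Sum.map₁ there) (free-guard ∀Q x ys ψ y fi)

free-matrix : ∀ R φ y → FreeIn y (matrix R φ) → y ∈ map proj₂ R ⊎ FreeIn y φ
free-matrix [] φ y fi = inj₂ fi
free-matrix (_ ∷ []) φ y fi = inj₂ fi
free-matrix ((z , x) ∷ p ∷ R) φ y fi =
  [ (λ { refl → inj₁ (here refl) }) ,
    [ (λ y∈ → inj₁ (there y∈)) , (λ fi' → Data.Sum.map₁ there (free-matrix (p ∷ R) φ y fi')) ] ]
  (free-guard z x (map proj₂ (p ∷ R)) (matrix (p ∷ R) φ) y fi)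

-- The rendered matrix only mentions output variables below m (and the
-- variable 0 in constants).
free-toQF : ∀ μ m y → 0 < m → AllN (Scope (Earlier m) []) μ → FreeIn y (toQF μ) → y < m
free-toQF μ m y 0<m sc fi = go μ sc fi
  where
  free-decF : ∀ {A : Set} (d : Dec A) → FreeIn y (decF d) → y < m
  free-decF (yes _) f≁ˡ = 0<m
  free-decF (yes _) f≁ʳ = 0<m
  free-decF (no _)  f∼ˡ = 0<m
  free-decF (no _)  f∼ʳ = 0<m
  go : ∀ μ → AllN (Scope (Earlier m) []) μ → FreeIn y (toQF μ) → y < m
  go mT sc fi = free-decF (yes tt) fi
  go mF sc fi = free-decF (no (λ (x : ⊥) → x)) fi
  go (eE (outVar i) (outVar j)) (i< , j<) f∼ˡ = i<
  go (eE (outVar i) (outVar j)) (i< , j<) f∼ʳ = j<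
  go (eN (outVar i) (outVar j)) (i< , j<) f≁ˡ = i<
  go (eN (outVar i) (outVar j)) (i< , j<) f≁ʳ = j<
  go (eEq a b) sc fi = free-decF (a ≟N b) fi
  go (eNe a b) sc fi = free-decF (¬? (a ≟N b)) fi
  go (bin conj μ ν) (sμ , sν) (f∧ˡ fi) = go μ sμ fi
  go (bin conj μ ν) (sμ , sν) (f∧ʳ fi) = go ν sν fi
  go (bin disj μ ν) (sμ , sν) (f∨ˡ fi) = go μ sμ fi
  go (bin disj μ ν) (sμ , sν) (f∨ʳ fi) = go ν sν fi

free-prefix : ∀ k zs ψ y → FreeIn y (prefix (num k zs) ψ) → FreeIn y ψ × (y < k ⊎ k + length zs ≤ y)
free-prefix k [] ψ y fi with y <? k
... | yes y<k = fi , inj₁ y<k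
... | no y≮k  = fi , inj₂ (subst (_≤ y) (sym (+-identityʳ k)) (≮⇒≥ y≮k))
free-prefix k (z ∷ zs) ψ y (fQ y≢k fi) with free-prefix (suc k) zs ψ y fi
... | f , inj₁ y<1+k = f , inj₁ (≤∧≢⇒< (≤-pred y<1+k) y≢k)
... | f , inj₂ k+≤y  = f , inj₂ (subst (_≤ y) (sym (+-suc k _)) k+≤y)

num-vars : ∀ k zs y → y ∈ map proj₂ (num k zs) → k ≤ y × y < k + length zs
num-vars k (z ∷ zs) y (here refl) = ≤-refl , subst (k <_) (sym (+-suc k _)) (s≤s (m≤m+n k _))
num-vars k (z ∷ zs) y (there m) with num-vars (suc k) zs y m
... | k<y , y< = <⇒≤ k<y , subst (y <_) (sym (+-suc k _)) y<

unique-num : ∀ k zs → Unique (map proj₂ (num k zs))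
unique-num k [] = []
unique-num k (z ∷ zs) =
  All.tabulate (λ {y} m k≡y → <-irrefl k≡y (proj₁ (num-vars (suc k) zs y m))) ∷ unique-num (suc k) zs

F-guard : ∀ z x ys ψ → F (guard z x ys ψ) ≡ F ψ
F-guard ∃Q x [] ψ = refl
F-guard ∃Q x (y ∷ ys) ψ = F-guard ∃Q x ys ψ
F-guard ∀Q x [] ψ = refl
F-guard ∀Q x (y ∷ ys) ψ = F-guard ∀Q x ys ψ

F-matrix : ∀ R ψ → F ψ ≡ [] → F (matrix R ψ) ≡ []
F-matrix [] ψ e = e
F-matrix (_ ∷ []) ψ e = e
F-matrix ((z , x) ∷ R@(_ ∷ _)) ψ e = trans (F-guard z x (map proj₂ R) (matrix R ψ)) (F-matrix R ψ e)

F-decF : ∀ {A : Set} (d : Dec A) → F (decF d) ≡ []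
F-decF (yes _) = refl
F-decF (no _)  = refl

F-toQF : ∀ μ → F (toQF μ) ≡ []
F-toQF mT = refl
F-toQF mF = refl
F-toQF (eE a b) = refl
F-toQF (eN a b) = refl
F-toQF (eEq a b) = F-decF (a ≟N b)
F-toQF (eNe a b) = F-decF (¬? (a ≟N b))
F-toQF (bin conj μ ν) rewrite F-toQF μ | F-toQF ν = refl
F-toQF (bin disj μ ν) rewrite F-toQF μ | F-toQF ν = refl

chChildren-prefix : ∀ ψ → F ψ ≡ [] → ∀ z k zs → chChildren z (F (prefix (num k zs) ψ)) ≡ changes z zs
chChildren-prefix ψ e z k [] rewrite e = refl
chChildren-prefix ψ e z k (w ∷ ws) =
  trans (⊔-identityʳ _) (cong (diff z w +_) (chChildren-prefix ψ e w (suc k) ws))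

-- The construction for the sentence ∃x φ: prenex it into c + 1 blocks,
-- where c = ch(∃x φ), open the first block with the vacuous ∃ on the
-- variable 0, and eliminate equality.
module Construction (x : ℕ) (φ : Form) where
  ψ₀ : Form
  ψ₀ = quant ∃Q x φ

  c : ℕ
  c = ch ψ₀

  prenexed : Blk (suc c) × M
  prenexed = pren ∃Q (suc c) ψ₀

  B₀ : List Name
  B₀ = Vec.head (proj₁ prenexed)

  Bs₀ : Blk c
  Bs₀ = Vec.tail (proj₁ prenexed)

  output rest : List Q × M
  output = openBlock 0 ∃Q prenexed
  rest = elimEq 1 ∃Q B₀ c Bs₀ (proj₂ prenexed ∷ [])

  kinds zs : List Q
  kinds = proj₁ output
  zs = proj₁ rest

  φ₁ : Form
  φ₁ = toQF (proj₂ output)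

  L : List (Q × ℕ)
  L = num 0 kinds

  -- The output sentence is ∃0 φ̂ = prefix L (matrix (reverse L) φ₁).
  φ̂ : Form
  φ̂ = prefix (num 1 zs) (matrix (reverse L) φ₁)

  ch-preserved : ch ψ₀ ≡ ch (quant ∃Q 0 φ̂)
  ch-preserved = begin
    c                        ≡⟨ sym (⊔-identityʳ c) ⟩
    c ⊔ 0                    ≡⟨ cong (_⊔ 0) (sym (elimEq-changes c 1 ∃Q B₀ Bs₀ (proj₂ prenexed ∷ []))) ⟩
    changes ∃Q zs ⊔ 0        ≡⟨ cong (_⊔ 0) (sym (chChildren-prefix _ matrix-flat ∃Q 1 zs)) ⟩
    chChildren ∃Q (F φ̂) ⊔ 0  ∎
    where
    open ≡-Reasoning
    matrix-flat : F (matrix (reverse L) φ₁) ≡ []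
    matrix-flat = F-matrix (reverse L) φ₁ (F-toQF (proj₂ output))

  module _ (sentence : Sentence ψ₀) where
    scoped : Scoped (Earlier 0) prenexed
    scoped = Scoped-mono prenexed (λ { (free y) fi → sentence y fi ; (bnd _) () ; (outVar _) () })
                         (pren-prenexed ψ₀ ∃Q (suc c))

    output-scope : AllN (Scope (Earlier (length kinds)) []) (proj₂ output)
    output-scope = openBlock-scope 0 ∃Q prenexed scoped

    -- Every variable of the matrix is below length kinds, and all of those
    -- are bound by the prefix.
    output-sentence : Sentence (quant ∃Q 0 φ̂)
    output-sentence y fi with free-prefix 0 kinds (matrix (reverse L) φ₁) y fi
    ... | fi' , inj₂ kinds≤y = <-irrefl refl (<-≤-trans (bound (free-matrix (reverse L) φ₁ y fi')) kinds≤y)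
      where
      bound : y ∈ map proj₂ (reverse L) ⊎ FreeIn y φ₁ → y < length kinds
      bound (inj₁ y∈) with ∈-map⁻ proj₂ y∈
      ... | p , p∈ , refl = proj₂ (num-vars 0 kinds _ (∈-map⁺ proj₂ (Anyₚ.reverse⁻ p∈)))
      bound (inj₂ fi'') = free-toQF (proj₂ output) (length kinds) y (s≤s z≤n) output-scope fi''

    same-free : SameFree ψ₀ (quant ∃Q 0 φ̂)
    same-free y = (λ fi → ⊥-elim (sentence y fi)) , (λ fi → ⊥-elim (output-sentence y fi))

    output-nepnf : NEPNF (quant ∃Q 0 φ̂)
    output-nepnf = L , φ₁ , toQF-qf (proj₂ output) , unique-num 0 kinds , refl

    output-sem : ∀ {n} (G : Graph n) ρ → length kinds < n → Sat G ρ ψ₀ ⇔ Sat G ρ (quant ∃Q 0 φ̂)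
    output-sem G ρ lt =
      ⇔.trans (PrenexSem.pren-sem G ψ₀ ∃Q (suc c) ≤-refl ρ τ (λ _ → refl))
     (⇔.trans (ElimSem.openBlock-sem G 0 ∃Q prenexed scoped τ lt)
     (⇔.trans (Render.bridge G (proj₂ output) kinds 0 ρ τ (λ _ → refl) (λ ()) output-scope)
              (⇔.sym (subst (λ R → Sat G ρ (prefix L (matrix R φ₁)) ⇔ Render.FSat G φ₁ ρ 0 kinds)
                            (Listₚ.++-identityʳ (reverse L)) (Render.nepnf-sem G φ₁ kinds 0 [] ρ refl lt)))))
      where
      τ : Sem.Env G
      τ (free y)   = ρ y
      τ (bnd _)    = ρ 0
      τ (outVar j) = ρ j

lemma3 : (x : ℕ) (φ : Form) → Sentence (quant ∃Q x φ) →
    Σ ℕ λ y → Σ Form λ φ̂ →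
      Sentence (quant ∃Q y φ̂) × NEPNF (quant ∃Q y φ̂) ×
      (quant ∃Q x φ ≅ quant ∃Q y φ̂) × (ch (quant ∃Q x φ) ≡ ch (quant ∃Q y φ̂))
lemma3 x φ sentence =
  0 , φ̂ , output-sentence sentence , output-nepnf sentence ,
  (same-free sentence , suc (length kinds) , (λ n lt G ρ → output-sem sentence G ρ lt)) ,
  ch-preserved
  where open Construction x φ
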